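{- For every integer $t \ge 2$ there exists $d_0$ such that the following holds. Let $D$ be a directed graph and $f : V(D) \to \mathbb{Z}_{\ge 2}$ a function with maximum value at most $t$, and let $d = \max\{\Delta^-(D), \Delta^+_{f-1}(D)\}$ with $d \ge d_0$. Let $k \le d^{9/10}$ be a positive integer. Then there is a coloring of $V(D)$ with colors $0, 1, \ldots, k-1$ such that for every vertex $v$ and every color $i$, the numbers $$d^-(v,i) = |\{u \in V(D) : (u,v) \in E(D),\ u \text{ has color } i\}|, \qquad d^+(v,i) = |\{u \in V(D) : (v,u) \in E(D),\ u \text{ has color } i\}|$$ satisfy $$d^-(v,i) \le \frac{d}{k} + 3\sqrt{\frac{d \log d}{k}} \quad\text{and}\quad \frac{d^+(v,i)}{f(v)-1} \le \frac{d}{k} + 3\sqrt{\frac{d \log d}{k}}.$$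
   Context: A directed graph has no loops and no parallel arcs (two arcs with the same tail and same head), but may have anti-parallel arcs; $(u,v)$ denotes an arc with tail $u$ and head $v$. $\Delta^-(D)$ is the maximum indegree; $\Delta^+_{f-1}(D) = \max_{v \in V(D)} \lceil d^+(v)/(f(v)-1) \rceil$, where $d^+(v)$ is the outdegree of $v$. -}

module Defs where

open import Data.Bool using (Bool; true; false)
open import Data.Nat using (ℕ; zero; suc; _+_; _*_; _∸_; _^_; _≤_; _⊔_)
open import Data.Nat.DivMod using (_/_)
open import Data.Fin using (Fin)
open import Data.List using (List; length; filterᵇ; map; foldr; allFin)
open import Data.Integer using (+_)
open import Data.Rational as ℚ using (ℚ; 0ℚ; 1ℚ)
open import Data.Sum using (_⊎_)
open import Relation.Binary.PropositionalEquality using (_≡_)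
open import Relation.Nullary.Decidable using (does)
open import Data.Bool using (_∧_)
import Data.Fin as F

-- A finite digraph on vertex set Fin n, given by its arc relation:
-- arc u v = true iff (u,v) is an arc (tail u, head v).  Using a relation
-- excludes parallel arcs automatically; anti-parallel arcs are allowed;
-- loops are excluded by noLoop.
record Digraph (n : ℕ) : Set where
  field
    arc    : Fin n → Fin n → Bool
    noLoop : ∀ v → arc v v ≡ false
open Digraph public

countFin : (n : ℕ) → (Fin n → Bool) → ℕ
countFin n p = length (filterᵇ p (allFin n))

maxFin : (n : ℕ) → (Fin n → ℕ) → ℕ
maxFin n g = foldr _⊔_ 0 (map g (allFin n))

indeg : ∀ {n} → Digraph n → Fin n → ℕ
indeg {n} D v = countFin n (λ u → arc D u v)

outdeg : ∀ {n} → Digraph n → Fin n → ℕ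
outdeg {n} D v = countFin n (λ u → arc D v u)

-- ceiling division ⌈a / b⌉ (only used with b ≥ 1; value 0 for b = 0)
ceilDiv : ℕ → ℕ → ℕ
ceilDiv a zero    = 0
ceilDiv a (suc b) = (a + b) / suc b

maxIndeg : ∀ {n} → Digraph n → ℕ
maxIndeg {n} D = maxFin n (indeg D)

-- Δ⁺_{f-1}(D) = max_v ⌈ d⁺(v) / (f(v) - 1) ⌉
maxOutdegF : ∀ {n} → Digraph n → (Fin n → ℕ) → ℕ
maxOutdegF {n} D f = maxFin n (λ v → ceilDiv (outdeg D v) (f v ∸ 1))

indegCol : ∀ {n k} → Digraph n → (Fin n → Fin k) → Fin n → Fin k → ℕ
indegCol {n} D c v i = countFin n (λ u → arc D u v ∧ does (c u F.≟ i))

outdegCol : ∀ {n k} → Digraph n → (Fin n → Fin k) → Fin n → Fin k → ℕ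
outdegCol {n} D c v i = countFin n (λ u → arc D v u ∧ does (c u F.≟ i))

expTerm : ℕ → ℕ → ℚ
expTerm a zero    = 1ℚ
expTerm a (suc j) = expTerm a j ℚ.* ((+ a) ℚ./ suc j)

expPartial : ℕ → ℕ → ℚ
expPartial a zero    = 0ℚ
expPartial a (suc n) = expPartial a n ℚ.+ expTerm a n

-- ExpLe a m  :⇔  e^a ≤ m  (e^a is the supremum of the increasing partial sums)
ExpLe : ℕ → ℕ → Set
ExpLe a m = ∀ n → expPartial a n ℚ.≤ ((+ m) ℚ./ 1)

-- Bound d k p r  :⇔  p / r ≤ d/k + 3 √(d · ln d / k)      (for d, k, r ≥ 1)
-- Derivation: if k p ≤ d r this holds trivially; otherwise it is equivalent to
--   (k p − d r)² ≤ 9 d k r² · ln d   ⇔   e^{(k p − d r)²} ≤ d^{9 d k r²}.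
Bound : (d k p r : ℕ) → Set
Bound d k p r =
  (k * p ≤ d * r) ⊎ ExpLe ((k * p ∸ d * r) ^ 2) (d ^ (9 * d * k * r ^ 2))

-- Colour the vertices uniformly at random.  For a vertex v and a colour i, the event that
-- d⁻(v,i) or d⁺(v,i)/(f(v) - 1) is too large depends only on the colours of the at most d t
-- neighbours of v, so the bad event of v shares coordinates with at most (d t)² others.
-- Weighting a colouring by (1 + 1/q)^X, where X is a colour-class size and
-- q ≈ √(d / (9 k log₃ d)), gives a Chernoff bound: each of the 2k tails at v has probability
-- below 1/(8k((d t)² + 1)), and the symmetric local lemma yields a colouring avoiding every
-- bad event.  Probabilities are counts of colourings, and the bound with e^((kp - dr)²) is
-- checked on the partial sums of the exponential series.

module Submission where

open import Defs
open import Data.Nat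
open import Data.Nat.Properties
open import Data.Nat.Tactic.RingSolver using (solve-∀)
open import Data.Bool using (Bool; true; false; _∧_; _∨_; not; T)
open import Data.Bool.Properties using (∧-conicalˡ; ∧-conicalʳ; ∨-conicalˡ; ∨-conicalʳ; ∨-comm; not-injective; T-≡)
open import Function.Bundles using (Equivalence)
open import Data.Fin using (Fin; zero; suc)
import Data.Fin as Fin
open import Data.Vec.Functional using (_∷_)
open import Data.List using (filterᵇ; length; tabulate; map; foldr)
open import Data.Product using (Σ; ∃; _×_; _,_; proj₁; proj₂)
open import Data.Empty using (⊥-elim)
open import Data.Unit using (tt)
open import Data.Sum using (inj₁; inj₂)
import Data.Integer as ℤ
import Data.Integer.Properties as ℤ
open import Data.Rational as ℚ using (toℚᵘ)
import Data.Rational.Properties as ℚ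
open import Data.Rational.Unnormalised as ℚᵘ using (ℚᵘ; mkℚᵘ; _≃_; *≡*; *≤*)
import Data.Rational.Unnormalised.Properties as ℚᵘ
open import Function using (_∘_)
open import Relation.Nullary using (yes; no; does)
open import Relation.Nullary.Decidable using (dec-true)
open import Relation.Binary.PropositionalEquality hiding (J)
open import Data.Nat.DivMod using (m≡m%n+[m/n]*n; m%n<n)
open import Algebra.Properties.Semiring.Sum +-*-semiring
  using (sum-syntax; sum-cong-≗; ∑-distrib-+; ∑-comm; *-distribˡ-sum; *-distribʳ-sum)
open import Algebra.Properties.CommutativeMonoid.Sum *-1-commutativeMonoid
  using () renaming (sum to ∏; sum-cong-≗ to ∏-cong-≗; ∑-distrib-+ to ∏-distrib-*)

⟦_⟧ : Bool → ℕ
⟦ true ⟧  = 1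
⟦ false ⟧ = 0

⟦⟧≤1 : ∀ b → ⟦ b ⟧ ≤ 1
⟦⟧≤1 true  = ≤-refl
⟦⟧≤1 false = z≤n

⟦∧⟧ : ∀ a b → ⟦ a ∧ b ⟧ ≡ ⟦ a ⟧ * ⟦ b ⟧
⟦∧⟧ true  b = sym (+-identityʳ ⟦ b ⟧)
⟦∧⟧ false b = refl

⟦∨⟧≤ : ∀ a b → ⟦ a ∨ b ⟧ ≤ ⟦ a ⟧ + ⟦ b ⟧
⟦∨⟧≤ true  b = s≤s z≤n
⟦∨⟧≤ false b = ≤-refl

⟦∧⟧+⟦∧not⟧ : ∀ a b → ⟦ a ∧ b ⟧ + ⟦ a ∧ not b ⟧ ≡ ⟦ a ⟧
⟦∧⟧+⟦∧not⟧ true  true  = refl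
⟦∧⟧+⟦∧not⟧ true  false = refl
⟦∧⟧+⟦∧not⟧ false b     = refl

⟦⟧>0 : ∀ {b} → 0 < ⟦ b ⟧ → b ≡ true
⟦⟧>0 {true} _ = refl

∑-mono-≤ : ∀ n {g h : Fin n → ℕ} → (∀ i → g i ≤ h i) → ∑[ i < n ] g i ≤ ∑[ i < n ] h i
∑-mono-≤ zero    g≤h = z≤n
∑-mono-≤ (suc n) g≤h = +-mono-≤ (g≤h zero) (∑-mono-≤ n (g≤h ∘ suc))

∑-mono-< : ∀ n {g h : Fin n → ℕ} i → (∀ j → g j ≤ h j) → g i < h i → ∑[ j < n ] g j < ∑[ j < n ] h j
∑-mono-< (suc n) zero    g≤h gi<hi = +-mono-<-≤ gi<hi (∑-mono-≤ n (g≤h ∘ suc))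
∑-mono-< (suc n) (suc i) g≤h gi<hi = +-mono-≤-< (g≤h zero) (∑-mono-< n i (g≤h ∘ suc) gi<hi)

∑-const : ∀ n a → ∑[ i < n ] a ≡ n * a
∑-const zero    a = refl
∑-const (suc n) a = cong (a +_) (∑-const n a)

∑-term-≤ : ∀ n (g : Fin n → ℕ) i → g i ≤ ∑[ j < n ] g j
∑-term-≤ (suc n) g zero    = m≤m+n (g zero) _
∑-term-≤ (suc n) g (suc i) = ≤-trans (∑-term-≤ n (g ∘ suc) i) (m≤n+m _ (g zero))

∑-pos : ∀ n (g : Fin n → ℕ) → 0 < ∑[ i < n ] g i → ∃ λ i → 0 < g i
∑-pos (suc n) g ∑>0 with g zero in eq
... | suc _ = zero , subst (0 <_) (sym eq) z<s
... | zero  = let i , gi>0 = ∑-pos n (g ∘ suc) ∑>0 in suc i , gi>0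

∑-⟦⟧≡0 : ∀ n (p : Fin n → Bool) → ∑[ i < n ] ⟦ p i ⟧ ≡ 0 → ∀ i → p i ≡ false
∑-⟦⟧≡0 n p ∑≡0 i with p i in pi | n≤0⇒n≡0 (subst (⟦ p i ⟧ ≤_) ∑≡0 (∑-term-≤ n (λ j → ⟦ p j ⟧) i))
... | false | _ = refl
... | true  | ()

∑-indicator-*-≤ : ∀ m (D : Fin m → Bool) (g : Fin m → ℕ) M c → (∀ w → D w ≡ true → g w * M ≤ c) →
  ∑[ w < m ] (⟦ D w ⟧ * g w) * M ≤ ∑[ w < m ] ⟦ D w ⟧ * c
∑-indicator-*-≤ zero    D g M c bound = z≤n
∑-indicator-*-≤ (suc m) D g M c bound = begin
  (⟦ D zero ⟧ * g zero + rest) * M              ≡⟨ *-distribʳ-+ M (⟦ D zero ⟧ * g zero) rest ⟩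
  ⟦ D zero ⟧ * g zero * M + rest * M            ≤⟨ +-mono-≤ (head-≤ (D zero) refl) (∑-indicator-*-≤ m (D ∘ suc) (g ∘ suc) M c (bound ∘ suc)) ⟩
  ⟦ D zero ⟧ * c + ∑[ w < m ] ⟦ D (suc w) ⟧ * c ≡⟨ *-distribʳ-+ c ⟦ D zero ⟧ _ ⟨
  (⟦ D zero ⟧ + ∑[ w < m ] ⟦ D (suc w) ⟧) * c   ∎
  where
  open ≤-Reasoning
  rest = ∑[ w < m ] (⟦ D (suc w) ⟧ * g (suc w))
  head-≤ : ∀ b → D zero ≡ b → ⟦ b ⟧ * g zero * M ≤ ⟦ b ⟧ * c
  head-≤ true  D0 rewrite *-identityˡ (g zero) | *-identityˡ c = bound zero D0
  head-≤ false _  = z≤n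

∑-δ : ∀ n (i : Fin n) → ∑[ j < n ] ⟦ does (j Fin.≟ i) ⟧ ≡ 1
∑-δ (suc n) zero    = cong suc (trans (∑-const n 0) (*-zeroʳ n))
∑-δ (suc n) (suc i) = ∑-δ n i

countFin-∑ : ∀ n (p : Fin n → Bool) → countFin n p ≡ ∑[ u < n ] ⟦ p u ⟧
countFin-∑ n p = length-filter-tabulate n (λ u → u)
  where
  length-filter-tabulate : ∀ m (h : Fin m → Fin n) →
    length (filterᵇ p (tabulate h)) ≡ ∑[ u < m ] ⟦ p (h u) ⟧
  length-filter-tabulate zero    h = refl
  length-filter-tabulate (suc m) h with p (h zero)
  ... | true  = cong suc (length-filter-tabulate m (h ∘ suc))
  ... | false = length-filter-tabulate m (h ∘ suc)

allᵇ : ∀ n → (Fin n → Bool) → Bool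
allᵇ zero    p = true
allᵇ (suc n) p = p zero ∧ allᵇ n (p ∘ suc)

anyᵇ : ∀ n → (Fin n → Bool) → Bool
anyᵇ zero    p = false
anyᵇ (suc n) p = p zero ∨ anyᵇ n (p ∘ suc)

allᵇ-elim : ∀ n {p : Fin n → Bool} → allᵇ n p ≡ true → ∀ i → p i ≡ true
allᵇ-elim (suc n) {p} all≡true i with p zero in p0 | i
... | true | zero  = p0
... | true | suc i = allᵇ-elim n all≡true i

allᵇ-intro : ∀ n {p : Fin n → Bool} → (∀ i → p i ≡ true) → allᵇ n p ≡ true
allᵇ-intro zero    p≡true = refl
allᵇ-intro (suc n) p≡true rewrite p≡true zero = allᵇ-intro n (p≡true ∘ suc)

allᵇ-witness : ∀ n {p : Fin n → Bool} → allᵇ n p ≡ false → ∃ λ i → p i ≡ false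
allᵇ-witness (suc n) {p} all≡false with p zero in p0
... | false = zero , p0
... | true  = let i , pi≡false = allᵇ-witness n all≡false in suc i , pi≡false

allᵇ-cong : ∀ n {p q : Fin n → Bool} → (∀ i → p i ≡ q i) → allᵇ n p ≡ allᵇ n q
allᵇ-cong zero    p≡q = refl
allᵇ-cong (suc n) p≡q = cong₂ _∧_ (p≡q zero) (allᵇ-cong n (p≡q ∘ suc))

anyᵇ-intro : ∀ n {p : Fin n → Bool} i → p i ≡ true → anyᵇ n p ≡ true
anyᵇ-intro (suc n) zero    pi≡true rewrite pi≡true = refl
anyᵇ-intro (suc n) {p} (suc i) pi≡true with p zero
... | true  = refl
... | false = anyᵇ-intro n i pi≡true

anyᵇ-elim : ∀ n {p : Fin n → Bool} → anyᵇ n p ≡ false → ∀ i → p i ≡ false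
anyᵇ-elim (suc n) {p} any≡false i with p zero in p0 | i
... | false | zero  = p0
... | false | suc i = anyᵇ-elim n any≡false i

anyᵇ-cong : ∀ n {p q : Fin n → Bool} → (∀ i → p i ≡ q i) → anyᵇ n p ≡ anyᵇ n q
anyᵇ-cong zero    p≡q = refl
anyᵇ-cong (suc n) p≡q = cong₂ _∨_ (p≡q zero) (anyᵇ-cong n (p≡q ∘ suc))

⟦anyᵇ⟧≤∑ : ∀ n (p : Fin n → Bool) → ⟦ anyᵇ n p ⟧ ≤ ∑[ i < n ] ⟦ p i ⟧
⟦anyᵇ⟧≤∑ zero    p = z≤n
⟦anyᵇ⟧≤∑ (suc n) p = ≤-trans (⟦∨⟧≤ (p zero) _) (+-monoʳ-≤ ⟦ p zero ⟧ (⟦anyᵇ⟧≤∑ n (p ∘ suc)))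

^-distribʳ-* : ∀ m n o → (m * n) ^ o ≡ m ^ o * n ^ o
^-distribʳ-* m n zero    = refl
^-distribʳ-* m n (suc o) = trans (cong (m * n *_) (^-distribʳ-* m n o)) (interchange m n (m ^ o) (n ^ o))
  where
  interchange : ∀ a b c d → a * b * (c * d) ≡ a * c * (b * d)
  interchange = solve-∀

∏-^ : ∀ n a (g : Fin n → ℕ) → ∏ (λ i → a ^ g i) ≡ a ^ ∑[ i < n ] g i
∏-^ zero    a g = refl
∏-^ (suc n) a g = trans (cong (a ^ g zero *_) (∏-^ n a (g ∘ suc))) (sym (^-distribˡ-+-* a (g zero) _))

-- Counting colourings

Colouring : ℕ → ℕ → Set
Colouring n k = Fin n → Fin k

∑ᶜ : ∀ n k → (Colouring n k → ℕ) → ℕ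
∑ᶜ zero    k g = g (λ ())
∑ᶜ (suc n) k g = ∑[ c < k ] ∑ᶜ n k (λ f → g (c ∷ f))

count : ∀ n k → (Colouring n k → Bool) → ℕ
count n k P = ∑ᶜ n k (λ f → ⟦ P f ⟧)

module _ {k : ℕ} where

  ∑ᶜ-cong : ∀ n {g h : Colouring n k → ℕ} → (∀ f → g f ≡ h f) → ∑ᶜ n k g ≡ ∑ᶜ n k h
  ∑ᶜ-cong zero    g≡h = g≡h _
  ∑ᶜ-cong (suc n) g≡h = sum-cong-≗ {k} (λ c → ∑ᶜ-cong n (λ f → g≡h (c ∷ f)))

  ∑ᶜ-mono-≤ : ∀ n {g h : Colouring n k → ℕ} → (∀ f → g f ≤ h f) → ∑ᶜ n k g ≤ ∑ᶜ n k h
  ∑ᶜ-mono-≤ zero    g≤h = g≤h _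
  ∑ᶜ-mono-≤ (suc n) g≤h = ∑-mono-≤ k (λ c → ∑ᶜ-mono-≤ n (λ f → g≤h (c ∷ f)))

  ∑ᶜ-distrib-+ : ∀ n (g h : Colouring n k → ℕ) → ∑ᶜ n k (λ f → g f + h f) ≡ ∑ᶜ n k g + ∑ᶜ n k h
  ∑ᶜ-distrib-+ zero    g h = refl
  ∑ᶜ-distrib-+ (suc n) g h =
    trans (sum-cong-≗ {k} (λ c → ∑ᶜ-distrib-+ n (λ f → g (c ∷ f)) (λ f → h (c ∷ f)))) (∑-distrib-+ {k} _ _)

  *-distribˡ-∑ᶜ : ∀ n a (g : Colouring n k → ℕ) → a * ∑ᶜ n k g ≡ ∑ᶜ n k (λ f → a * g f)
  *-distribˡ-∑ᶜ zero    a g = refl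
  *-distribˡ-∑ᶜ (suc n) a g =
    trans (*-distribˡ-sum {k} a _) (sum-cong-≗ {k} (λ c → *-distribˡ-∑ᶜ n a (λ f → g (c ∷ f))))

  ∑ᶜ-const : ∀ n a → ∑ᶜ n k (λ _ → a) ≡ k ^ n * a
  ∑ᶜ-const zero    a = sym (+-identityʳ a)
  ∑ᶜ-const (suc n) a = begin
    ∑[ c < k ] ∑ᶜ n k (λ _ → a) ≡⟨ sum-cong-≗ {k} (λ _ → ∑ᶜ-const n a) ⟩
    ∑[ c < k ] (k ^ n * a)      ≡⟨ ∑-const k _ ⟩
    k * (k ^ n * a)             ≡⟨ *-assoc k (k ^ n) a ⟨
    k ^ suc n * a               ∎
    where open ≡-Reasoning

  ∑ᶜ-∑ : ∀ n m (g : Fin m → Colouring n k → ℕ) →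
    ∑ᶜ n k (λ f → ∑[ i < m ] g i f) ≡ ∑[ i < m ] ∑ᶜ n k (g i)
  ∑ᶜ-∑ n zero    g = trans (∑ᶜ-const n 0) (*-zeroʳ (k ^ n))
  ∑ᶜ-∑ n (suc m) g = trans (∑ᶜ-distrib-+ n (g zero) _) (cong (∑ᶜ n k (g zero) +_) (∑ᶜ-∑ n m (g ∘ suc)))

  ∑ᶜ-pos : ∀ n (g : Colouring n k → ℕ) → 0 < ∑ᶜ n k g → ∃ λ f → 0 < g f
  ∑ᶜ-pos zero    g ∑>0 = _ , ∑>0
  ∑ᶜ-pos (suc n) g ∑>0 =
    let c , c>0 = ∑-pos k _ ∑>0
        f , f>0 = ∑ᶜ-pos n _ c>0
    in c ∷ f , f>0

  ∑ᶜ-∏ : ∀ n (w : Fin n → Fin k → ℕ) → ∑ᶜ n k (λ f → ∏ (λ u → w u (f u))) ≡ ∏ (λ u → ∑[ c < k ] w u c)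
  ∑ᶜ-∏ zero    w = refl
  ∑ᶜ-∏ (suc n) w = begin
    ∑[ c < k ] ∑ᶜ n k (λ f → w zero c * ∏ (λ u → w (suc u) (f u)))
      ≡⟨ sum-cong-≗ {k} (λ c → *-distribˡ-∑ᶜ n (w zero c) _) ⟨
    ∑[ c < k ] (w zero c * ∑ᶜ n k (λ f → ∏ (λ u → w (suc u) (f u))))
      ≡⟨ *-distribʳ-sum {k} _ (w zero) ⟨
    ∑[ c < k ] w zero c * ∑ᶜ n k (λ f → ∏ (λ u → w (suc u) (f u)))
      ≡⟨ cong (∑[ c < k ] w zero c *_) (∑ᶜ-∏ n (w ∘ suc)) ⟩
    ∑[ c < k ] w zero c * ∏ (λ u → ∑[ c < k ] w (suc u) c)
      ∎
    where open ≡-Reasoning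

  count-mono : ∀ n (P Q : Colouring n k → Bool) → (∀ f → P f ≡ true → Q f ≡ true) → count n k P ≤ count n k Q
  count-mono n P Q P⇒Q = ∑ᶜ-mono-≤ n (λ f → ⟦⟧-mono (P f) (P⇒Q f))
    where
    ⟦⟧-mono : ∀ a {b} → (a ≡ true → b ≡ true) → ⟦ a ⟧ ≤ ⟦ b ⟧
    ⟦⟧-mono true  a⇒b rewrite a⇒b refl = ≤-refl
    ⟦⟧-mono false a⇒b = z≤n

  count-cong : ∀ n (P Q : Colouring n k → Bool) → (∀ f → P f ≡ Q f) → count n k P ≡ count n k Q
  count-cong n P Q P≡Q = ∑ᶜ-cong n (λ f → cong ⟦_⟧ (P≡Q f))

Agree : ∀ {n k} → (Fin n → Bool) → Colouring n k → Colouring n k → Set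
Agree S f g = ∀ u → S u ≡ true → f u ≡ g u

DependsOnlyOn : ∀ {n k} → (Fin n → Bool) → (Colouring n k → Bool) → Set
DependsOnlyOn S P = ∀ f g → Agree S f g → P f ≡ P g

module _ {n k : ℕ} {S : Fin (suc n) → Bool} {P : Colouring (suc n) k → Bool} (P-local : DependsOnlyOn S P) where

  dependsOnlyOn-∷ : ∀ c → DependsOnlyOn (S ∘ suc) (λ f → P (c ∷ f))
  dependsOnlyOn-∷ c f g agree = P-local (c ∷ f) (c ∷ g) agree-∷
    where
    agree-∷ : Agree S (c ∷ f) (c ∷ g)
    agree-∷ zero    _   = refl
    agree-∷ (suc u) Ssu = agree u Ssu

  ignores-head : S zero ≡ false → ∀ c c' f → P (c ∷ f) ≡ P (c' ∷ f)
  ignores-head S0≡false c c' f = P-local (c ∷ f) (c' ∷ f) agree-∷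
    where
    agree-∷ : Agree S (c ∷ f) (c' ∷ f)
    agree-∷ zero    S0≡true with () ← trans (sym S0≡false) S0≡true
    agree-∷ (suc u) _       = refl

∑-*-constʳ : ∀ k (a b : Fin k → ℕ) → (∀ c c' → b c ≡ b c') →
  ∑[ c < k ] (a c * b c) * k ≡ ∑[ c < k ] a c * ∑[ c < k ] b c
∑-*-constʳ zero    a b b-const = refl
∑-*-constʳ (suc k) a b b-const = begin
  ∑[ c < suc k ] (a c * b c) * suc k ≡⟨ cong (_* suc k) (sum-cong-≗ {suc k} (λ c → cong (a c *_) (b-const c zero))) ⟩
  ∑[ c < suc k ] (a c * b₀) * suc k  ≡⟨ cong (_* suc k) (*-distribʳ-sum {suc k} b₀ a) ⟨
  ∑a * b₀ * suc k                    ≡⟨ *-assoc ∑a b₀ (suc k) ⟩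
  ∑a * (b₀ * suc k)                  ≡⟨ cong (∑a *_) (trans (*-comm b₀ (suc k)) (sym (∑-const (suc k) b₀))) ⟩
  ∑a * ∑[ c < suc k ] b₀             ≡⟨ cong (∑a *_) (sum-cong-≗ {suc k} (b-const zero)) ⟩
  ∑a * ∑[ c < suc k ] b c            ∎
  where
  open ≡-Reasoning
  b₀ = b zero
  ∑a = ∑[ c < suc k ] a c

count-∧-independent : ∀ n k (S : Fin n → Bool) (P Q : Colouring n k → Bool) →
  DependsOnlyOn S P → DependsOnlyOn (not ∘ S) Q →
  count n k (λ f → P f ∧ Q f) * k ^ n ≡ count n k P * count n k Q
count-∧-independent zero    k S P Q _ _ = trans (*-identityʳ _) (⟦∧⟧ (P _) (Q _))
count-∧-independent (suc n) k S P Q P-local Q-local = begin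
  ∑[ c < k ] X c * (k * k ^ n)    ≡⟨ *-assoc (∑[ c < k ] X c) k (k ^ n) ⟨
  ∑[ c < k ] X c * k * k ^ n      ≡⟨ *-comm _ (k ^ n) ⟩
  k ^ n * (∑[ c < k ] X c * k)    ≡⟨ *-assoc (k ^ n) _ k ⟨
  k ^ n * ∑[ c < k ] X c * k      ≡⟨ cong (_* k) (*-distribˡ-sum {k} (k ^ n) X) ⟩
  ∑[ c < k ] (k ^ n * X c) * k    ≡⟨ cong (_* k) (sum-cong-≗ {k} (λ c → trans (*-comm (k ^ n) (X c)) (IH c))) ⟩
  ∑[ c < k ] (a c * b c) * k      ≡⟨ split (S zero) refl ⟩
  ∑[ c < k ] a c * ∑[ c < k ] b c ∎
  where
  open ≡-Reasoning
  X a b : Fin k → ℕ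
  X c = count n k (λ f → P (c ∷ f) ∧ Q (c ∷ f))
  a c = count n k (λ f → P (c ∷ f))
  b c = count n k (λ f → Q (c ∷ f))
  IH : ∀ c → X c * k ^ n ≡ a c * b c
  IH c = count-∧-independent n k (S ∘ suc) _ _ (dependsOnlyOn-∷ P-local c) (dependsOnlyOn-∷ Q-local c)
  split : ∀ s → S zero ≡ s → ∑[ c < k ] (a c * b c) * k ≡ ∑[ c < k ] a c * ∑[ c < k ] b c
  split true  S0 = ∑-*-constʳ k a b λ c c' →
    count-cong n (λ f → Q (c ∷ f)) _ (ignores-head Q-local (cong not S0) c c')
  split false S0 = begin
    ∑[ c < k ] (a c * b c) * k      ≡⟨ cong (_* k) (sum-cong-≗ {k} (λ c → *-comm (a c) (b c))) ⟩
    ∑[ c < k ] (b c * a c) * k      ≡⟨ ∑-*-constʳ k b a (λ c c' → count-cong n (λ f → P (c ∷ f)) _ (ignores-head P-local S0 c c')) ⟩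
    ∑[ c < k ] b c * ∑[ c < k ] a c ≡⟨ *-comm (∑[ c < k ] b c) _ ⟩
    ∑[ c < k ] a c * ∑[ c < k ] b c ∎

-- The symmetric local lemma

module LocalLemma {m n k : ℕ} .{{_ : NonZero k}}
  (bad : Fin m → Colouring n k → Bool)
  (scope : Fin m → Fin n → Bool)
  (bad-local : ∀ v → DependsOnlyOn (scope v) (bad v))
  (Δ : ℕ)
  (few-overlaps : ∀ v → ∑[ w < m ] ⟦ anyᵇ n (λ u → scope v u ∧ scope w u) ⟧ ≤ Δ)
  (rare : ∀ v → count n k (bad v) * (4 * suc Δ) ≤ k ^ n)
  where

  M : ℕ
  M = 4 * suc Δ

  overlaps : Fin m → Fin m → Bool
  overlaps v w = anyᵇ n (λ u → scope v u ∧ scope w u)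

  avoids : (Fin m → Bool) → Colouring n k → Bool
  avoids T f = allᵇ m (λ w → not (T w ∧ bad w f))

  N : (Fin m → Bool) → ℕ
  N T = count n k (avoids T)

  size : (Fin m → Bool) → ℕ
  size T = ∑[ w < m ] ⟦ T w ⟧

  near far : Fin m → (Fin m → Bool) → Fin m → Bool
  near v T w = T w ∧ overlaps v w
  far  v T w = T w ∧ not (overlaps v w)

  avoids-antitone : ∀ T T' f → (∀ w → T' w ≡ true → T w ≡ true) → avoids T f ≡ true → avoids T' f ≡ true
  avoids-antitone T T' f T'⊆T avoidsT = allᵇ-intro m (λ w → term w (T' w) refl)
    where
    term : ∀ w b → T' w ≡ b → not (b ∧ bad w f) ≡ true
    term w false _   = refl
    term w true  T'w = subst (λ x → not (x ∧ bad w f) ≡ true) (T'⊆T w T'w) (allᵇ-elim m avoidsT w)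

  far-local : ∀ v T → DependsOnlyOn (not ∘ scope v) (avoids (far v T))
  far-local v T f g agree = allᵇ-cong m term
    where
    term : ∀ w → not (far v T w ∧ bad w f) ≡ not (far v T w ∧ bad w g)
    term w with far v T w in farw
    ... | false = refl
    ... | true  = cong not (bad-local w f g (λ u wu → agree u (outside u wu)))
      where
      no-overlaps : overlaps v w ≡ false
      no-overlaps = not-injective (∧-conicalʳ (T w) _ farw)
      outside : ∀ u → scope w u ≡ true → not (scope v u) ≡ true
      outside u wu with scope v u in vu
      ... | false = refl
      ... | true  with () ← trans (sym (anyᵇ-intro n u (cong₂ _∧_ vu wu))) no-overlaps

  bad-avoiding-far : ∀ v T → count n k (λ f → bad v f ∧ avoids (far v T) f) * M ≤ N (far v T)
  bad-avoiding-far v T = *-cancelʳ-≤ _ _ (k ^ n) {{m^n≢0 k n}} (begin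
    c * M * k ^ n              ≡⟨ swap c M (k ^ n) ⟩
    c * k ^ n * M              ≡⟨ cong (_* M) (count-∧-independent n k (scope v) _ _ (bad-local v) (far-local v T)) ⟩
    count n k (bad v) * N' * M ≡⟨ swap (count n k (bad v)) N' M ⟩
    count n k (bad v) * M * N' ≤⟨ *-monoˡ-≤ N' (rare v) ⟩
    k ^ n * N'                 ≡⟨ *-comm (k ^ n) N' ⟩
    N' * k ^ n                 ∎)
    where
    open ≤-Reasoning
    c  = count n k (λ f → bad v f ∧ avoids (far v T) f)
    N' = N (far v T)
    swap : ∀ a b c → a * b * c ≡ a * c * b
    swap = solve-∀

  avoids-drop : ∀ T T' (D : Fin m → Bool) → (∀ w → T w ≡ true → T' w ≡ false → D w ≡ true) → ∀ f →
    ⟦ avoids T' f ⟧ ≤ ⟦ avoids T f ⟧ + ∑[ w < m ] (⟦ D w ⟧ * ⟦ bad w f ∧ avoids T' f ⟧)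
  avoids-drop T T' D T⊆T'∪D f with avoids T f in avoidsT | avoids T' f in avoidsT'
  ... | true  | b     = ≤-trans (⟦⟧≤1 b) (m≤m+n 1 (∑[ w < m ] (⟦ D w ⟧ * ⟦ bad w f ∧ b ⟧)))
  ... | false | false = z≤n
  ... | false | true  = ≤-trans (witness-term (D w) (T⊆T'∪D w Tw (T'-misses (allᵇ-elim m avoidsT' w))) badw)
                                (∑-term-≤ m (λ w → ⟦ D w ⟧ * ⟦ bad w f ∧ true ⟧) w)
    where
    w   = proj₁ (allᵇ-witness m avoidsT)
    hit = not-injective (proj₂ (allᵇ-witness m avoidsT))
    Tw : T w ≡ true
    Tw = ∧-conicalˡ (T w) _ hit
    badw : bad w f ≡ true
    badw = ∧-conicalʳ (T w) _ hit
    T'-misses : not (T' w ∧ bad w f) ≡ true → T' w ≡ false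
    T'-misses avoid with T' w
    ... | false = refl
    ... | true  with () ← trans (sym avoid) (cong not badw)
    witness-term : ∀ d {b} → d ≡ true → b ≡ true → 1 ≤ ⟦ d ⟧ * ⟦ b ∧ true ⟧
    witness-term true refl refl = ≤-refl

  count-drop : ∀ T T' (D : Fin m → Bool) → (∀ w → T w ≡ true → T' w ≡ false → D w ≡ true) →
    N T' ≤ N T + ∑[ w < m ] (⟦ D w ⟧ * count n k (λ f → bad w f ∧ avoids T' f))
  count-drop T T' D T⊆T'∪D = begin
    N T'
      ≤⟨ ∑ᶜ-mono-≤ n (avoids-drop T T' D T⊆T'∪D) ⟩
    ∑ᶜ n k (λ f → ⟦ avoids T f ⟧ + ∑[ w < m ] (⟦ D w ⟧ * ⟦ bad w f ∧ avoids T' f ⟧))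
      ≡⟨ ∑ᶜ-distrib-+ n _ _ ⟩
    N T + ∑ᶜ n k (λ f → ∑[ w < m ] (⟦ D w ⟧ * ⟦ bad w f ∧ avoids T' f ⟧))
      ≡⟨ cong (N T +_) (∑ᶜ-∑ n m (λ w f → ⟦ D w ⟧ * ⟦ bad w f ∧ avoids T' f ⟧)) ⟩
    N T + ∑[ w < m ] ∑ᶜ n k (λ f → ⟦ D w ⟧ * ⟦ bad w f ∧ avoids T' f ⟧)
      ≡⟨ cong (N T +_) (sum-cong-≗ {m} (λ w → *-distribˡ-∑ᶜ n ⟦ D w ⟧ _)) ⟨
    N T + ∑[ w < m ] (⟦ D w ⟧ * count n k (λ f → bad w f ∧ avoids T' f))
      ∎
    where open ≤-Reasoning

  size-split : ∀ v T → size T ≡ size (near v T) + size (far v T)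
  size-split v T = trans (sym (sum-cong-≗ {m} (λ w → ⟦∧⟧+⟦∧not⟧ (T w) (overlaps v w)))) (∑-distrib-+ {m} _ _)

  size-near : ∀ v T → size (near v T) ≤ Δ
  size-near v T = ≤-trans (∑-mono-≤ m (λ w → ⟦∧⟧≤ʳ (T w) (overlaps v w))) (few-overlaps v)
    where
    ⟦∧⟧≤ʳ : ∀ a b → ⟦ a ∧ b ⟧ ≤ ⟦ b ⟧
    ⟦∧⟧≤ʳ true  b = ≤-refl
    ⟦∧⟧≤ʳ false b = z≤n

  near-empty : ∀ v T → size (near v T) ≡ 0 → N (far v T) ≡ N T
  near-empty v T size≡0 = count-cong n _ _ (λ f → allᵇ-cong m (λ w →
      cong (λ x → not (x ∧ bad w f)) (far≡T (T w) (overlaps v w) (∑-⟦⟧≡0 m (near v T) size≡0 w))))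
    where
    far≡T : ∀ a b → a ∧ b ≡ false → a ∧ not b ≡ a
    far≡T true  false _ = refl
    far≡T false b     _ = refl

  halve : ∀ {x y z} → x ≤ y + z → z * M ≤ Δ * (2 * x) → x ≤ 2 * y
  halve {x} {y} {z} x≤y+z zM≤ = *-cancelʳ-≤ x (2 * y) (4 + 2 * Δ) (+-cancelʳ-≤ (Δ * (2 * x)) _ _ (begin
    x * (4 + 2 * Δ) + Δ * (2 * x)     ≡⟨ split-M x Δ ⟩
    x * M                             ≤⟨ *-monoˡ-≤ M x≤y+z ⟩
    (y + z) * M                       ≡⟨ *-distribʳ-+ M y z ⟩
    y * M + z * M                     ≤⟨ +-monoʳ-≤ (y * M) zM≤ ⟩
    y * M + Δ * (2 * x)               ≤⟨ +-monoˡ-≤ (Δ * (2 * x)) (≤-trans (m≤m+n (y * M) (4 * y)) (≤-reflexive (double-M y Δ))) ⟩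
    2 * y * (4 + 2 * Δ) + Δ * (2 * x) ∎))
    where
    open ≤-Reasoning
    split-M : ∀ x Δ → x * (4 + 2 * Δ) + Δ * (2 * x) ≡ x * (4 * suc Δ)
    split-M = solve-∀
    double-M : ∀ y Δ → y * (4 * suc Δ) + 4 * y ≡ 2 * y * (4 + 2 * Δ)
    double-M = solve-∀

  positive : ∀ {x y z} → 0 < x → x ≤ y + z → z * M ≤ 2 * x → 0 < y
  positive {x} {zero} {z} x>0 x≤z zM≤2x = ⊥-elim (<⇒≱ 2x<xM (≤-trans (*-monoˡ-≤ M x≤z) zM≤2x))
    where
    2x<xM : 2 * x < x * M
    2x<xM = ≤-trans (*-monoˡ-< x {{>-nonZero x>0}} {2} {4} (s≤s (s≤s (s≤s z≤n))))
                    (≤-trans (≤-reflexive (*-comm 4 x)) (*-monoʳ-≤ x (m≤m*n 4 (suc Δ))))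
  positive {y = suc _} _ _ _ = z<s

  -- P(bad v | avoids T) ≤ 2/M by induction on |T|: bad v is independent of the members of T whose
  -- scopes miss scope v, and the at most Δ others are handled by the induction hypothesis
  bad-given-avoid : ∀ s T → size T ≤ s → ∀ v → count n k (λ f → bad v f ∧ avoids T f) * M ≤ 2 * N T
  far-avoid-≤ : ∀ s T v → size T ≤ s → N (far v T) ≤ 2 * N T

  bad-given-avoid s T size≤s v = begin
    count n k (λ f → bad v f ∧ avoids T f) * M
      ≤⟨ *-monoˡ-≤ M (count-mono n _ _ (λ f bad∧avoid →
           cong₂ _∧_ (∧-conicalˡ (bad v f) _ bad∧avoid)
                     (avoids-antitone T (far v T) f (λ w → ∧-conicalˡ (T w) _) (∧-conicalʳ (bad v f) _ bad∧avoid)))) ⟩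
    count n k (λ f → bad v f ∧ avoids (far v T) f) * M
      ≤⟨ bad-avoiding-far v T ⟩
    N (far v T)
      ≤⟨ far-avoid-≤ s T v size≤s ⟩
    2 * N T
      ∎
    where open ≤-Reasoning

  far-avoid-≤ s T v size≤s with size (near v T) in size-near≡
  ... | zero = ≤-trans (≤-reflexive (near-empty v T size-near≡)) (m≤m+n (N T) _)
  far-avoid-≤ zero T v size≤s | suc _
    with () ← ≤-trans (≤-reflexive (trans (cong (_+ size (far v T)) (sym size-near≡)) (sym (size-split v T)))) size≤s
  far-avoid-≤ (suc s) T v size≤s | suc z =
    halve {N (far v T)} {N T} (count-drop T (far v T) (near v T) T⊆far∪near)
      (≤-trans (∑-indicator-*-≤ m (near v T) (λ w → count n k (λ f → bad w f ∧ avoids (far v T) f)) M (2 * N (far v T))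
                 λ w _ → bad-given-avoid s (far v T) far-smaller w)
               (*-monoˡ-≤ _ (size-near v T)))
    where
    T⊆far∪near : ∀ w → T w ≡ true → far v T w ≡ false → near v T w ≡ true
    T⊆far∪near w Tw farw rewrite Tw = not-injective farw
    far-smaller : size (far v T) ≤ s
    far-smaller = ≤-pred (begin
      suc (size (far v T))             ≤⟨ s≤s (m≤n+m _ z) ⟩
      suc z + size (far v T)           ≡⟨ cong (_+ size (far v T)) size-near≡ ⟨
      size (near v T) + size (far v T) ≡⟨ size-split v T ⟨
      size T                           ≤⟨ size≤s ⟩
      suc s                            ∎)
      where open ≤-Reasoning

  size-≤ : ∀ T → size T ≤ m
  size-≤ T = ≤-trans (∑-mono-≤ m (λ w → ⟦⟧≤1 (T w))) (≤-reflexive (trans (∑-const m 1) (*-identityʳ m)))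

  avoid-pos : ∀ s T → size T ≤ s → 0 < N T
  avoid-pos s T size≤s with size T in size≡
  ... | zero = subst (0 <_) (sym N≡kⁿ) (m^n>0 k n)
    where
    N≡kⁿ : N T ≡ k ^ n
    N≡kⁿ = begin
      N T                       ≡⟨ count-cong n _ (λ _ → true) (λ f → allᵇ-intro m (λ w →
                                     cong (λ x → not (x ∧ bad w f)) (∑-⟦⟧≡0 m T size≡ w))) ⟩
      ∑ᶜ n k (λ _ → 1) ≡⟨ ∑ᶜ-const n 1 ⟩
      k ^ n * 1        ≡⟨ *-identityʳ (k ^ n) ⟩
      k ^ n            ∎
      where open ≡-Reasoning
  avoid-pos zero    T () | suc _
  avoid-pos (suc s) T size≤s | suc _ =
    positive {N T'} (avoid-pos s T' T'-smaller)
      (count-drop T T' (λ w → does (w Fin.≟ v)) T⊆T'∪v)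
      (≤-trans (∑-indicator-*-≤ m (λ w → does (w Fin.≟ v)) (λ w → count n k (λ f → bad w f ∧ avoids T' f)) M (2 * N T')
                  λ w _ → bad-given-avoid m T' (size-≤ T') w)
               (≤-reflexive (trans (cong (_* (2 * N T')) (∑-δ m v)) (*-identityˡ _))))
    where
    v  = proj₁ (∑-pos m (λ w → ⟦ T w ⟧) (subst (0 <_) (sym size≡) z<s))
    Tv : T v ≡ true
    Tv = ⟦⟧>0 (proj₂ (∑-pos m (λ w → ⟦ T w ⟧) (subst (0 <_) (sym size≡) z<s)))
    T' : Fin m → Bool
    T' w = T w ∧ not (does (w Fin.≟ v))
    T⊆T'∪v : ∀ w → T w ≡ true → T' w ≡ false → does (w Fin.≟ v) ≡ true
    T⊆T'∪v w Tw T'w rewrite Tw = not-injective T'w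
    T'-smaller : size T' ≤ s
    T'-smaller = ≤-pred (≤-trans (∑-mono-< m v (λ w → ⟦T'⟧≤⟦T⟧ (T w) (does (w Fin.≟ v))) T'v<Tv) (≤-trans (≤-reflexive size≡) size≤s))
      where
      ⟦T'⟧≤⟦T⟧ : ∀ a b → ⟦ a ∧ not b ⟧ ≤ ⟦ a ⟧
      ⟦T'⟧≤⟦T⟧ false b     = z≤n
      ⟦T'⟧≤⟦T⟧ true  true  = z≤n
      ⟦T'⟧≤⟦T⟧ true  false = ≤-refl
      T'v<Tv : ⟦ T' v ⟧ < ⟦ T v ⟧
      T'v<Tv rewrite Tv | dec-true (v Fin.≟ v) refl = z<s

  lovász-local-lemma : ∃ λ f → ∀ v → bad v f ≡ false
  lovász-local-lemma =
    let f , f-avoids = ∑ᶜ-pos n _ (avoid-pos m (λ _ → true) (size-≤ (λ _ → true)))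
    in f , λ v → not-injective (allᵇ-elim m (⟦⟧>0 f-avoids) v)

-- Exponential moments of a colour class

module ColourClassTail {n k : ℕ} (S : Fin n → Bool) (i : Fin k) (q : ℕ) where

  hits misses : Colouring n k → Fin n → Bool
  hits   f u = S u ∧ does (f u Fin.≟ i)
  misses f u = S u ∧ not (does (f u Fin.≟ i))

  X Y : Colouring n k → ℕ
  X f = ∑[ u < n ] ⟦ hits f u ⟧
  Y f = ∑[ u < n ] ⟦ misses f u ⟧

  m : ℕ
  m = ∑[ u < n ] ⟦ S u ⟧

  X+Y≡m : ∀ f → X f + Y f ≡ m
  X+Y≡m f = trans (sym (∑-distrib-+ {n} _ _)) (sum-cong-≗ {n} (λ u → ⟦∧⟧+⟦∧not⟧ (S u) _))

  -- the weight (1 + 1/q)^X, scaled by q^m to stay in ℕ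
  weight : Colouring n k → ℕ
  weight f = ∏ (λ u → suc q ^ ⟦ hits f u ⟧ * q ^ ⟦ misses f u ⟧)

  weight≡ : ∀ f → weight f ≡ suc q ^ X f * q ^ Y f
  weight≡ f = begin
    ∏ (λ u → suc q ^ ⟦ hits f u ⟧ * q ^ ⟦ misses f u ⟧)           ≡⟨ ∏-distrib-* {n} _ _ ⟩
    ∏ (λ u → suc q ^ ⟦ hits f u ⟧) * ∏ (λ u → q ^ ⟦ misses f u ⟧) ≡⟨ cong₂ _*_ (∏-^ n (suc q) _) (∏-^ n q _) ⟩
    suc q ^ X f * q ^ Y f                                         ∎
    where open ≡-Reasoning

  weight-≥ : ∀ P f → P ≤ X f → suc q ^ P * q ^ m ≤ weight f * q ^ P
  weight-≥ P f P≤X = begin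
    suc q ^ P * q ^ m                         ≡⟨ cong (λ e → suc q ^ P * q ^ e) (trans (sym (X+Y≡m f)) (cong (_+ Y f) (sym X≡))) ⟩
    suc q ^ P * q ^ (P + e + Y f)             ≡⟨ cong (suc q ^ P *_) (powers q P e (Y f)) ⟩
    suc q ^ P * (q ^ e * q ^ Y f * q ^ P)     ≤⟨ *-monoʳ-≤ (suc q ^ P) (*-monoˡ-≤ (q ^ P) (*-monoˡ-≤ (q ^ Y f) (^-monoˡ-≤ e (n≤1+n q)))) ⟩
    suc q ^ P * (suc q ^ e * q ^ Y f * q ^ P) ≡⟨ regroup (suc q ^ P) (suc q ^ e) (q ^ Y f) (q ^ P) ⟩
    suc q ^ P * suc q ^ e * q ^ Y f * q ^ P   ≡⟨ cong (λ x → x * q ^ Y f * q ^ P) (sym (^-distribˡ-+-* (suc q) P e)) ⟩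
    suc q ^ (P + e) * q ^ Y f * q ^ P         ≡⟨ cong (λ x → suc q ^ x * q ^ Y f * q ^ P) X≡ ⟩
    suc q ^ X f * q ^ Y f * q ^ P             ≡⟨ cong (_* q ^ P) (weight≡ f) ⟨
    weight f * q ^ P                          ∎
    where
    open ≤-Reasoning
    e = X f ∸ P
    X≡ : P + e ≡ X f
    X≡ = m+[n∸m]≡n P≤X
    powers : ∀ q a b c → q ^ (a + b + c) ≡ q ^ b * q ^ c * q ^ a
    powers q a b c = begin-equality
      q ^ (a + b + c)       ≡⟨ ^-distribˡ-+-* q (a + b) c ⟩
      q ^ (a + b) * q ^ c   ≡⟨ cong (_* q ^ c) (^-distribˡ-+-* q a b) ⟩
      q ^ a * q ^ b * q ^ c ≡⟨ rotate (q ^ a) (q ^ b) (q ^ c) ⟩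
      q ^ b * q ^ c * q ^ a ∎
      where
      rotate : ∀ x y z → x * y * z ≡ y * z * x
      rotate = solve-∀
    regroup : ∀ a b c d → a * (b * c * d) ≡ a * b * c * d
    regroup = solve-∀

  ∑-colour-weight : ∀ u → ∑[ c < k ] (suc q ^ ⟦ S u ∧ does (c Fin.≟ i) ⟧ * q ^ ⟦ S u ∧ not (does (c Fin.≟ i)) ⟧)
                          ≡ (k * q + 1) ^ ⟦ S u ⟧ * k ^ ⟦ not (S u) ⟧
  ∑-colour-weight u with S u
  ... | false = trans (∑-const k 1) (sym (+-identityʳ (k * 1)))
  ... | true  = begin
    ∑[ c < k ] (suc q ^ ⟦ does (c Fin.≟ i) ⟧ * q ^ ⟦ not (does (c Fin.≟ i)) ⟧) ≡⟨ sum-cong-≗ {k} (λ c → term (does (c Fin.≟ i))) ⟩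
    ∑[ c < k ] (q + ⟦ does (c Fin.≟ i) ⟧)                                      ≡⟨ ∑-distrib-+ {k} _ _ ⟩
    ∑[ c < k ] q + ∑[ c < k ] ⟦ does (c Fin.≟ i) ⟧                             ≡⟨ cong₂ _+_ (∑-const k q) (∑-δ k i) ⟩
    k * q + 1                                                                  ≡⟨ trans (*-identityʳ _) (*-identityʳ _) ⟨
    (k * q + 1) ^ 1 * k ^ 0                                                    ∎
    where
    open ≡-Reasoning
    term : ∀ b → suc q ^ ⟦ b ⟧ * q ^ ⟦ not b ⟧ ≡ q + ⟦ b ⟧
    term true  = trans (*-identityʳ (suc q * 1)) (trans (*-identityʳ (suc q)) (+-comm 1 q))
    term false = trans (+-identityʳ (q * 1)) (trans (*-identityʳ q) (sym (+-identityʳ q)))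

  ∑ᶜ-weight : ∑ᶜ n k weight * k ^ m ≡ (k * q + 1) ^ m * k ^ n
  ∑ᶜ-weight = begin
    ∑ᶜ n k weight * k ^ m
      ≡⟨ cong (_* k ^ m) (∑ᶜ-∏ n (λ u c → suc q ^ ⟦ S u ∧ does (c Fin.≟ i) ⟧ * q ^ ⟦ S u ∧ not (does (c Fin.≟ i)) ⟧)) ⟩
    ∏ (λ u → ∑[ c < k ] (suc q ^ ⟦ S u ∧ does (c Fin.≟ i) ⟧ * q ^ ⟦ S u ∧ not (does (c Fin.≟ i)) ⟧)) * k ^ m
      ≡⟨ cong (_* k ^ m) (∏-cong-≗ {n} ∑-colour-weight) ⟩
    ∏ (λ u → (k * q + 1) ^ ⟦ S u ⟧ * k ^ ⟦ not (S u) ⟧) * k ^ m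
      ≡⟨ cong (_* k ^ m) (trans (∏-distrib-* {n} _ _) (cong₂ _*_ (∏-^ n _ _) (∏-^ n k _))) ⟩
    (k * q + 1) ^ m * k ^ m' * k ^ m
      ≡⟨ *-assoc ((k * q + 1) ^ m) (k ^ m') (k ^ m) ⟩
    (k * q + 1) ^ m * (k ^ m' * k ^ m)
      ≡⟨ cong ((k * q + 1) ^ m *_) (sym (^-distribˡ-+-* k m' m)) ⟩
    (k * q + 1) ^ m * k ^ (m' + m)
      ≡⟨ cong (λ e → (k * q + 1) ^ m * k ^ e) m'+m≡n ⟩
    (k * q + 1) ^ m * k ^ n
      ∎
    where
    open ≡-Reasoning
    m' = ∑[ u < n ] ⟦ not (S u) ⟧
    m'+m≡n : m' + m ≡ n
    m'+m≡n = begin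
      m' + m                               ≡⟨ ∑-distrib-+ {n} _ _ ⟨
      ∑[ u < n ] (⟦ not (S u) ⟧ + ⟦ S u ⟧) ≡⟨ sum-cong-≗ {n} (λ u → trans (+-comm ⟦ not (S u) ⟧ _) (⟦∧⟧+⟦∧not⟧ true (S u))) ⟩
      ∑[ u < n ] 1                         ≡⟨ trans (∑-const n 1) (*-identityʳ n) ⟩
      n                                    ∎

  tail-bound : ∀ P → count n k (λ f → P ≤ᵇ X f) * (suc q ^ P * (k * q) ^ m) ≤ q ^ P * ((k * q + 1) ^ m * k ^ n)
  tail-bound P = begin
    c * (suc q ^ P * (k * q) ^ m)     ≡⟨ cong (λ x → c * (suc q ^ P * x)) (^-distribʳ-* k q m) ⟩
    c * (suc q ^ P * (k ^ m * q ^ m)) ≡⟨ regroup c (suc q ^ P) (k ^ m) (q ^ m) ⟩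
    k ^ m * (suc q ^ P * q ^ m * c)   ≡⟨ cong (k ^ m *_) (*-distribˡ-∑ᶜ n (suc q ^ P * q ^ m) _) ⟩
    k ^ m * ∑ᶜ n k (λ f → suc q ^ P * q ^ m * ⟦ P ≤ᵇ X f ⟧)
                                                 ≤⟨ *-monoʳ-≤ (k ^ m) (∑ᶜ-mono-≤ n markov) ⟩
    k ^ m * ∑ᶜ n k (λ f → q ^ P * weight f) ≡⟨ cong (k ^ m *_) (*-distribˡ-∑ᶜ n (q ^ P) weight) ⟨
    k ^ m * (q ^ P * ∑ᶜ n k weight)         ≡⟨ regroup' (k ^ m) (q ^ P) (∑ᶜ n k weight) ⟩
    q ^ P * (∑ᶜ n k weight * k ^ m)         ≡⟨ cong (q ^ P *_) ∑ᶜ-weight ⟩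
    q ^ P * ((k * q + 1) ^ m * k ^ n)       ∎
    where
    open ≤-Reasoning
    c = count n k (λ f → P ≤ᵇ X f)
    regroup : ∀ c a b d → c * (a * (b * d)) ≡ b * (a * d * c)
    regroup = solve-∀
    regroup' : ∀ a b c → a * (b * c) ≡ b * (c * a)
    regroup' = solve-∀
    markov : ∀ f → suc q ^ P * q ^ m * ⟦ P ≤ᵇ X f ⟧ ≤ q ^ P * weight f
    markov f with P ≤ᵇ X f in P≤ᵇX
    ... | false = ≤-trans (≤-reflexive (*-zeroʳ (suc q ^ P * q ^ m))) z≤n
    ... | true  = begin
      suc q ^ P * q ^ m * 1 ≡⟨ *-identityʳ _ ⟩
      suc q ^ P * q ^ m     ≤⟨ weight-≥ P f (≤ᵇ⇒≤ P (X f) (subst T (sym P≤ᵇX) _)) ⟩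
      weight f * q ^ P      ≡⟨ *-comm (weight f) _ ⟩
      q ^ P * weight f      ∎

-- Ratios and powers

infix 4 _÷_≤_÷_

record _÷_≤_÷_ (a b c d : ℕ) : Set where
  constructor ÷≤
  field cross : a * d ≤ c * b

open _÷_≤_÷_ public

÷-refl : ∀ {a b} → a ÷ b ≤ a ÷ b
÷-refl = ÷≤ ≤-refl

÷-reflexive : ∀ {a b c d} → a * d ≡ c * b → a ÷ b ≤ c ÷ d
÷-reflexive eq = ÷≤ (≤-reflexive eq)

÷-cong : ∀ {a b c d a' b' c' d'} → a ≡ a' → b ≡ b' → c ≡ c' → d ≡ d' → a ÷ b ≤ c ÷ d → a' ÷ b' ≤ c' ÷ d'
÷-cong refl refl refl refl r = r

÷-trans : ∀ {a b c d e f} → 0 < d → a ÷ b ≤ c ÷ d → c ÷ d ≤ e ÷ f → a ÷ b ≤ e ÷ f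
÷-trans {a} {b} {c} {d} {e} {f} d>0 (÷≤ ad≤cb) (÷≤ cf≤ed) = ÷≤ (*-cancelʳ-≤ (a * f) (e * b) d {{>-nonZero d>0}} (begin
  a * f * d ≡⟨ swap a f d ⟩
  a * d * f ≤⟨ *-monoˡ-≤ f ad≤cb ⟩
  c * b * f ≡⟨ swap c b f ⟩
  c * f * b ≤⟨ *-monoˡ-≤ b cf≤ed ⟩
  e * d * b ≡⟨ swap e d b ⟩
  e * b * d ∎))
  where
  open ≤-Reasoning
  swap : ∀ x y z → x * y * z ≡ x * z * y
  swap = solve-∀

÷-mul : ∀ {a b c d a' b' c' d'} → a ÷ b ≤ c ÷ d → a' ÷ b' ≤ c' ÷ d' → a * a' ÷ b * b' ≤ c * c' ÷ d * d'
÷-mul {a} {b} {c} {d} {a'} {b'} {c'} {d'} (÷≤ ad≤cb) (÷≤ ad≤cb') = ÷≤ (begin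
  a * a' * (d * d') ≡⟨ interchange a a' d d' ⟩
  a * d * (a' * d') ≤⟨ *-mono-≤ ad≤cb ad≤cb' ⟩
  c * b * (c' * b') ≡⟨ interchange c c' b b' ⟨
  c * c' * (b * b') ∎)
  where
  open ≤-Reasoning
  interchange : ∀ x y z w → x * y * (z * w) ≡ x * z * (y * w)
  interchange = solve-∀

÷-pow : ∀ {a b c d} n → a ÷ b ≤ c ÷ d → a ^ n ÷ b ^ n ≤ c ^ n ÷ d ^ n
÷-pow zero    r = ÷-refl
÷-pow (suc n) r = ÷-mul r (÷-pow n r)

÷-cancel : ∀ {a b c d} x → 0 < x → a ÷ b ≤ x * c ÷ x * d → a ÷ b ≤ c ÷ d
÷-cancel {a} {b} {c} {d} x x>0 (÷≤ cross) = ÷≤ (*-cancelˡ-≤ x {{>-nonZero x>0}} (begin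
  x * (a * d) ≡⟨ x-swap x a d ⟩
  a * (x * d) ≤⟨ cross ⟩
  x * c * b   ≡⟨ *-assoc x c b ⟩
  x * (c * b) ∎))
  where
  open ≤-Reasoning
  x-swap : ∀ x a d → x * (a * d) ≡ a * (x * d)
  x-swap = solve-∀

÷-pow-mono : ∀ {a b} m n → b ≤ a → m ≤ n → a ^ m ÷ b ^ m ≤ a ^ n ÷ b ^ n
÷-pow-mono {a} {b} m n b≤a m≤n = ÷≤ (begin
  a ^ m * b ^ n           ≡⟨ cong (λ e → a ^ m * b ^ e) (sym m+e≡n) ⟩
  a ^ m * b ^ (m + e)     ≡⟨ cong (a ^ m *_) (^-distribˡ-+-* b m e) ⟩
  a ^ m * (b ^ m * b ^ e) ≤⟨ *-monoʳ-≤ (a ^ m) (*-monoʳ-≤ (b ^ m) (^-monoˡ-≤ e b≤a)) ⟩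
  a ^ m * (b ^ m * a ^ e) ≡⟨ swap (a ^ m) (b ^ m) (a ^ e) ⟩
  a ^ m * a ^ e * b ^ m   ≡⟨ cong (_* b ^ m) (^-distribˡ-+-* a m e) ⟨
  a ^ (m + e) * b ^ m     ≡⟨ cong (λ e → a ^ e * b ^ m) m+e≡n ⟩
  a ^ n * b ^ m           ∎)
  where
  open ≤-Reasoning
  e = n ∸ m
  m+e≡n = m+[n∸m]≡n m≤n
  swap : ∀ x y z → x * (y * z) ≡ x * z * y
  swap = solve-∀

bernoulli : ∀ N K → N ^ K * (N + K) ≤ (N + 1) ^ K * N
bernoulli N zero    = ≤-reflexive (cong (1 *_) (+-identityʳ N))
bernoulli N (suc K) = begin
  N * N ^ K * (N + suc K)     ≡⟨ rotate N (N ^ K) (N + suc K) ⟩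
  N ^ K * (N * (N + suc K))   ≤⟨ *-monoʳ-≤ (N ^ K) (≤-trans (m≤m+n _ K) (≤-reflexive (sym (expand N K)))) ⟩
  N ^ K * ((N + 1) * (N + K)) ≡⟨ swap (N ^ K) (N + 1) (N + K) ⟩
  (N + 1) * (N ^ K * (N + K)) ≤⟨ *-monoʳ-≤ (N + 1) (bernoulli N K) ⟩
  (N + 1) * ((N + 1) ^ K * N) ≡⟨ *-assoc (N + 1) ((N + 1) ^ K) N ⟨
  (N + 1) * (N + 1) ^ K * N   ∎
  where
  open ≤-Reasoning
  rotate : ∀ x y z → x * y * z ≡ y * (x * z)
  rotate = solve-∀
  swap : ∀ x y z → x * (y * z) ≡ y * (x * z)
  swap = solve-∀
  expand : ∀ N K → (N + 1) * (N + K) ≡ N * (N + suc K) + K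
  expand = solve-∀

-- (1 + 1/N)^K ≥ 1 + K/N + K(K-1)/(2N²), stated for K + 1
bernoulli₂ : ∀ N K → N ^ suc K * (2 * N * N + 2 * suc K * N + suc K * K) ≤ (N + 1) ^ suc K * (2 * N * N)
bernoulli₂ N zero    = ≤-reflexive (base N)
  where
  base : ∀ N → N * 1 * (2 * N * N + 2 * 1 * N + 1 * 0) ≡ (N + 1) * 1 * (2 * N * N)
  base = solve-∀
bernoulli₂ N (suc K) = begin
  N * N ^ suc K * L (suc K)                 ≡⟨ rotate N (N ^ suc K) _ ⟩
  N ^ suc K * (N * L (suc K))               ≤⟨ *-monoʳ-≤ (N ^ suc K) (≤-trans (m≤m+n _ _) (≤-reflexive (sym (step N K)))) ⟩
  N ^ suc K * ((N + 1) * L K)               ≡⟨ swap (N ^ suc K) (N + 1) (L K) ⟩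
  (N + 1) * (N ^ suc K * L K)               ≤⟨ *-monoʳ-≤ (N + 1) (bernoulli₂ N K) ⟩
  (N + 1) * ((N + 1) ^ suc K * (2 * N * N)) ≡⟨ *-assoc (N + 1) _ _ ⟨
  (N + 1) * (N + 1) ^ suc K * (2 * N * N)   ∎
  where
  open ≤-Reasoning
  L : ℕ → ℕ
  L K = 2 * N * N + 2 * suc K * N + suc K * K
  rotate : ∀ x y z → x * y * z ≡ y * (x * z)
  rotate = solve-∀
  swap : ∀ x y z → x * (y * z) ≡ y * (x * z)
  swap = solve-∀
  step : ∀ N K → (N + 1) * (2 * N * N + 2 * suc K * N + suc K * K)
               ≡ N * (2 * N * N + 2 * suc (suc K) * N + suc (suc K) * suc K) + suc K * K
  step = solve-∀

bernoulli-upper : ∀ N K j → K + j ≡ N → (N + 1) ^ K * j ≤ N ^ K * N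
bernoulli-upper N zero    j K+j≡N = ≤-reflexive (trans (*-identityˡ j) (trans K+j≡N (sym (*-identityˡ N))))
bernoulli-upper N (suc K) j K+j≡N = begin
  (N + 1) * (N + 1) ^ K * j   ≡⟨ rotate (N + 1) ((N + 1) ^ K) j ⟩
  (N + 1) ^ K * ((N + 1) * j) ≤⟨ *-monoʳ-≤ ((N + 1) ^ K) (≤-trans (≤-reflexive (expand N j)) (+-monoʳ-≤ (N * j) j≤N)) ⟩
  (N + 1) ^ K * (N * j + N)   ≡⟨ cong ((N + 1) ^ K *_) (trans (+-comm (N * j) N) (sym (*-suc N j))) ⟩
  (N + 1) ^ K * (N * suc j)   ≡⟨ swap ((N + 1) ^ K) N (suc j) ⟩
  N * ((N + 1) ^ K * suc j)   ≤⟨ *-monoʳ-≤ N (bernoulli-upper N K (suc j) (trans (+-suc K j) K+j≡N)) ⟩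
  N * (N ^ K * N)             ≡⟨ *-assoc N (N ^ K) N ⟨
  N * N ^ K * N               ∎
  where
  open ≤-Reasoning
  j≤N : j ≤ N
  j≤N = subst (j ≤_) K+j≡N (m≤n+m j (suc K))
  rotate : ∀ x y z → x * y * z ≡ y * (x * z)
  rotate = solve-∀
  swap : ∀ x y z → x * (y * z) ≡ y * (x * z)
  swap = solve-∀
  expand : ∀ N j → (N + 1) * j ≡ N * j + j
  expand = solve-∀

pow-upper-quadratic : ∀ N a K → 51 * K * a ≤ 2 * N →
  (N + a) ^ K * (100 * N * N) ≤ N ^ K * (100 * N * N + 100 * K * a * N + 51 * K * K * a * a)
pow-upper-quadratic N a zero    _ = ≤-reflexive (base N a)
  where
  base : ∀ N a → 1 * (100 * N * N) ≡ 1 * (100 * N * N + 100 * 0 * a * N + 51 * 0 * 0 * a * a)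
  base = solve-∀
pow-upper-quadratic N a (suc K) small = begin
  (N + a) * (N + a) ^ K * (100 * N * N)   ≡⟨ *-assoc (N + a) _ _ ⟩
  (N + a) * ((N + a) ^ K * (100 * N * N)) ≤⟨ *-monoʳ-≤ (N + a) (pow-upper-quadratic N a K (≤-trans (*-monoˡ-≤ a (*-monoʳ-≤ 51 (n≤1+n K))) small)) ⟩
  (N + a) * (N ^ K * Q K)                 ≡⟨ swap (N + a) (N ^ K) (Q K) ⟩
  N ^ K * ((N + a) * Q K)                 ≤⟨ *-monoʳ-≤ (N ^ K) step ⟩
  N ^ K * (N * Q (suc K))                 ≡⟨ *-assoc (N ^ K) N _ ⟨
  N ^ K * N * Q (suc K)                   ≡⟨ cong (_* Q (suc K)) (*-comm (N ^ K) N) ⟩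
  N * N ^ K * Q (suc K)                   ∎
  where
  open ≤-Reasoning
  Q : ℕ → ℕ
  Q K = 100 * N * N + 100 * K * a * N + 51 * K * K * a * a
  swap : ∀ x y z → x * (y * z) ≡ y * (x * z)
  swap = solve-∀
  expand : ∀ N a K → (N + a) * (100 * N * N + 100 * K * a * N + 51 * K * K * a * a) + (2 * K * a * a * N + 51 * a * a * N)
         ≡ N * (100 * N * N + 100 * suc K * a * N + 51 * suc K * suc K * a * a) + 51 * K * K * a * a * a
  expand = solve-∀
  cubic-small : 51 * K * K * a * a * a ≤ 2 * K * a * a * N
  cubic-small = begin
    51 * K * K * a * a * a     ≡⟨ split K a ⟩
    (51 * K * a) * (K * a * a) ≤⟨ *-monoˡ-≤ (K * a * a) (≤-trans (*-monoˡ-≤ a (*-monoʳ-≤ 51 (n≤1+n K))) small) ⟩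
    2 * N * (K * a * a)        ≡⟨ merge N K a ⟩
    2 * K * a * a * N          ∎
    where
    split : ∀ K a → 51 * K * K * a * a * a ≡ (51 * K * a) * (K * a * a)
    split = solve-∀
    merge : ∀ N K a → 2 * N * (K * a * a) ≡ 2 * K * a * a * N
    merge = solve-∀
  step : (N + a) * Q K ≤ N * Q (suc K)
  step = +-cancelʳ-≤ (2 * K * a * a * N + 51 * a * a * N) _ _ (begin
    (N + a) * Q K + (2 * K * a * a * N + 51 * a * a * N) ≡⟨ expand N a K ⟩
    N * Q (suc K) + 51 * K * K * a * a * a               ≤⟨ +-monoʳ-≤ (N * Q (suc K)) (≤-trans cubic-small (m≤m+n _ _)) ⟩
    N * Q (suc K) + (2 * K * a * a * N + 51 * a * a * N) ∎)

-- The exponential series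

succ-pow-≤ : ∀ a → suc a ^ a ≤ 3 * a ^ a
succ-pow-≤ zero    = s≤s z≤n
succ-pow-≤ (suc a) = ≤-trans (≤-reflexive (sym (*-identityʳ _))) (cross ratio)
  where
  a' = suc a
  N  = a' * 6
  -- (1 + 1/a)^a ≤ (1 + 1/(6a))^(6a) ≤ (6/5)^6 < 3
  ratio₁ : suc a' ÷ a' ≤ (N + 1) ^ 6 ÷ N ^ 6
  ratio₁ = ÷≤ (*-cancelʳ-≤ _ _ 6 (begin
    suc a' * N ^ 6 * 6     ≡⟨ regroup a' (N ^ 6) ⟩
    N ^ 6 * (a' * 6 + 6)   ≤⟨ bernoulli N 6 ⟩
    (N + 1) ^ 6 * (a' * 6) ≡⟨ *-assoc ((N + 1) ^ 6) a' 6 ⟨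
    (N + 1) ^ 6 * a' * 6   ∎))
    where
    open ≤-Reasoning
    regroup : ∀ a y → suc a * y * 6 ≡ y * (a * 6 + 6)
    regroup = solve-∀
  ratio₂ : (N + 1) ^ a' ÷ N ^ a' ≤ 6 ÷ 5
  ratio₂ = ÷≤ (*-cancelʳ-≤ _ _ a' (begin
    (N + 1) ^ a' * 5 * a'   ≡⟨ regroup ((N + 1) ^ a') a' ⟩
    (N + 1) ^ a' * (a' * 5) ≤⟨ bernoulli-upper N a' (a' * 5) (split a') ⟩
    N ^ a' * N              ≡⟨ regroup' (N ^ a') a' ⟩
    6 * N ^ a' * a'         ∎))
    where
    open ≤-Reasoning
    regroup : ∀ x a → x * 5 * a ≡ x * (a * 5)
    regroup = solve-∀
    split : ∀ a → a + a * 5 ≡ a * 6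
    split = solve-∀
    regroup' : ∀ y a → y * (a * 6) ≡ 6 * y * a
    regroup' = solve-∀
  6a≡a6 : ∀ x → (x ^ a') ^ 6 ≡ x ^ (6 * a')
  6a≡a6 x = trans (^-*-assoc x a' 6) (cong (x ^_) (*-comm a' 6))
  ratio : suc a' ^ a' ÷ a' ^ a' ≤ 3 ÷ 1
  ratio = ÷-trans (m^n>0 5 6)
            (÷-trans (m^n>0 N (6 * a'))
              (÷-cong refl refl (^-*-assoc (N + 1) 6 a') (^-*-assoc N 6 a') (÷-pow a' ratio₁))
              (÷-cong (6a≡a6 (N + 1)) (6a≡a6 N) refl refl (÷-pow 6 ratio₂)))
            (÷≤ (m≤m+n 46656 (46875 ∸ 46656)))

pow-self-≤ : ∀ a → a ^ a ≤ 3 ^ a * a !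
pow-self-≤ zero    = ≤-refl
pow-self-≤ (suc a) = begin
  suc a * suc a ^ a           ≤⟨ *-monoʳ-≤ (suc a) (succ-pow-≤ a) ⟩
  suc a * (3 * a ^ a)         ≤⟨ *-monoʳ-≤ (suc a) (*-monoʳ-≤ 3 (pow-self-≤ a)) ⟩
  suc a * (3 * (3 ^ a * a !)) ≡⟨ regroup (suc a) (3 ^ a) (a !) ⟩
  3 * 3 ^ a * (suc a * a !)   ∎
  where
  open ≤-Reasoning
  regroup : ∀ x y z → x * (3 * (y * z)) ≡ 3 * y * (x * z)
  regroup = solve-∀

-- a^j / j! is largest at j = a
pow-≤-3^*! : ∀ a j → a ^ j ≤ 3 ^ a * j !
pow-≤-3^*! a j with ≤-total j a
... | inj₁ j≤a = below (a ∸ j) j (m+[n∸m]≡n j≤a)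
  where
  below : ∀ d j → j + d ≡ a → a ^ j ≤ 3 ^ a * j !
  below zero    j j+0≡a = subst (λ i → a ^ i ≤ 3 ^ a * i !) (trans (sym j+0≡a) (+-identityʳ j)) (pow-self-≤ a)
  below (suc d) j j+d≡a = *-cancelˡ-≤ a {{>-nonZero a>0}} (begin
    a * a ^ j             ≤⟨ below d (suc j) (trans (sym (+-suc j d)) j+d≡a) ⟩
    3 ^ a * (suc j * j !) ≤⟨ *-monoʳ-≤ (3 ^ a) (*-monoˡ-≤ (j !) j<a) ⟩
    3 ^ a * (a * j !)     ≡⟨ regroup (3 ^ a) a (j !) ⟩
    a * (3 ^ a * j !)     ∎)
    where
    open ≤-Reasoning
    j<a : j < a
    j<a = subst (j <_) j+d≡a (m<m+n j z<s)
    a>0 : 0 < a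
    a>0 = ≤-trans z<s j<a
    regroup : ∀ x y z → x * (y * z) ≡ y * (x * z)
    regroup = solve-∀
... | inj₂ a≤j = subst (λ i → a ^ i ≤ 3 ^ a * i !) (m+[n∸m]≡n a≤j) (above (j ∸ a))
  where
  above : ∀ e → a ^ (a + e) ≤ 3 ^ a * (a + e) !
  above zero    = subst (λ i → a ^ i ≤ 3 ^ a * i !) (sym (+-identityʳ a)) (pow-self-≤ a)
  above (suc e) = subst (λ i → a ^ i ≤ 3 ^ a * i !) (sym (+-suc a e)) (begin
    a * a ^ (a + e)                   ≤⟨ *-monoʳ-≤ a (above e) ⟩
    a * (3 ^ a * (a + e) !)           ≤⟨ *-monoˡ-≤ _ (≤-trans (m≤m+n a e) (n≤1+n _)) ⟩
    suc (a + e) * (3 ^ a * (a + e) !) ≡⟨ regroup (suc (a + e)) (3 ^ a) ((a + e) !) ⟩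
    3 ^ a * (suc (a + e) * (a + e) !) ∎)
    where
    open ≤-Reasoning
    regroup : ∀ x y z → x * (y * z) ≡ y * (x * z)
    regroup = solve-∀

-- n ! · Σ_{j<n} a^j / j!
scaledExpSum : ℕ → ℕ → ℕ
scaledExpSum a zero    = 0
scaledExpSum a (suc n) = (scaledExpSum a n + a ^ n) * suc n

scaledExpSum-≤-linear : ∀ a n → scaledExpSum a n ≤ n * (3 ^ a * n !)
scaledExpSum-≤-linear a zero    = z≤n
scaledExpSum-≤-linear a (suc n) = begin
  (scaledExpSum a n + a ^ n) * suc n        ≤⟨ *-monoˡ-≤ (suc n) (+-mono-≤ (scaledExpSum-≤-linear a n) (pow-≤-3^*! a n)) ⟩
  (n * (3 ^ a * n !) + 3 ^ a * n !) * suc n ≡⟨ regroup n (3 ^ a) (n !) ⟩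
  suc n * (3 ^ a * (suc n * n !))           ∎
  where
  open ≤-Reasoning
  regroup : ∀ n x y → (n * (x * y) + x * y) * suc n ≡ suc n * (x * (suc n * y))
  regroup = solve-∀

-- beyond j = 2a the terms a^j / j! at least halve at each step
scaledExpSum-tail : ∀ a e → scaledExpSum a (a * 2 + e) + 2 * a ^ (a * 2 + e) ≤ (a * 2 + 2) * (3 ^ a * (a * 2 + e) !)
scaledExpSum-tail a zero = subst (λ n → scaledExpSum a n + 2 * a ^ n ≤ (a * 2 + 2) * (3 ^ a * n !)) (sym (+-identityʳ (a * 2))) (begin
  scaledExpSum a (a * 2) + 2 * a ^ (a * 2)
    ≤⟨ +-mono-≤ (scaledExpSum-≤-linear a (a * 2)) (*-monoʳ-≤ 2 (pow-≤-3^*! a (a * 2))) ⟩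
  a * 2 * (3 ^ a * (a * 2) !) + 2 * (3 ^ a * (a * 2) !)
    ≡⟨ *-distribʳ-+ _ (a * 2) 2 ⟨
  (a * 2 + 2) * (3 ^ a * (a * 2) !)
    ∎)
  where open ≤-Reasoning
scaledExpSum-tail a (suc e) = subst (λ n → scaledExpSum a n + 2 * a ^ n ≤ (a * 2 + 2) * (3 ^ a * n !)) (sym (+-suc (a * 2) e)) (begin
  (P + a ^ n) * suc n + 2 * (a * a ^ n) ≡⟨ regroup₁ P (a ^ n) (suc n) a ⟩
  (P + a ^ n) * suc n + a * 2 * a ^ n   ≤⟨ +-monoʳ-≤ ((P + a ^ n) * suc n) (*-monoˡ-≤ (a ^ n) 2a≤n+1) ⟩
  (P + a ^ n) * suc n + suc n * a ^ n   ≡⟨ regroup₂ P (a ^ n) (suc n) ⟩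
  (P + 2 * a ^ n) * suc n               ≤⟨ *-monoˡ-≤ (suc n) (scaledExpSum-tail a e) ⟩
  (a * 2 + 2) * (3 ^ a * n !) * suc n   ≡⟨ regroup₃ (a * 2 + 2) (3 ^ a) (n !) (suc n) ⟩
  (a * 2 + 2) * (3 ^ a * (suc n * n !)) ∎)
  where
  open ≤-Reasoning
  n = a * 2 + e
  P = scaledExpSum a n
  2a≤n+1 : a * 2 ≤ suc n
  2a≤n+1 = ≤-trans (m≤m+n (a * 2) e) (n≤1+n _)
  regroup₁ : ∀ P x s a → (P + x) * s + 2 * (a * x) ≡ (P + x) * s + a * 2 * x
  regroup₁ = solve-∀
  regroup₂ : ∀ P x s → (P + x) * s + s * x ≡ (P + 2 * x) * s
  regroup₂ = solve-∀
  regroup₃ : ∀ c x y z → c * (x * y) * z ≡ c * (x * (z * y))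
  regroup₃ = solve-∀

scaledExpSum-≤ : ∀ a n → scaledExpSum a n ≤ (a * 2 + 2) * 3 ^ a * n !
scaledExpSum-≤ a n rewrite *-assoc (a * 2 + 2) (3 ^ a) (n !) with ≤-total n (a * 2)
... | inj₁ n≤2a = ≤-trans (scaledExpSum-≤-linear a n) (*-monoˡ-≤ _ (≤-trans n≤2a (m≤m+n (a * 2) 2)))
... | inj₂ 2a≤n = subst (λ i → scaledExpSum a i ≤ (a * 2 + 2) * (3 ^ a * i !)) (m+[n∸m]≡n 2a≤n)
                    (≤-trans (m≤m+n _ _) (scaledExpSum-tail a (n ∸ a * 2)))

-- mkℚᵘ stores the denominator minus one; pred! n is n ! minus one
frac : ℕ → ℕ → ℚᵘ
frac x d = mkℚᵘ (ℤ.+ x) d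

pred! : ℕ → ℕ
pred! zero    = 0
pred! (suc n) = n + pred! n * suc n

suc-pred! : ∀ n → suc (pred! n) ≡ n !
suc-pred! zero    = refl
suc-pred! (suc n) = trans (cong (_* suc n) (suc-pred! n)) (*-comm (n !) (suc n))

frac-≃ : ∀ {x d y e} → x * suc e ≡ y * suc d → frac x d ≃ frac y e
frac-≃ {x} {d} {y} {e} eq = *≡* (trans (sym (ℤ.pos-* x (suc e))) (trans (cong ℤ.+_ eq) (ℤ.pos-* y (suc d))))

frac-≤ : ∀ {x d y e} → x * suc e ≤ y * suc d → frac x d ℚᵘ.≤ frac y e
frac-≤ {x} {d} {y} {e} le = *≤* (subst₂ ℤ._≤_ (ℤ.pos-* x (suc e)) (ℤ.pos-* y (suc d)) (ℤ.+≤+ le))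

frac-* : ∀ x d y e → frac x d ℚᵘ.* frac y e ≃ frac (x * y) (e + d * suc e)
frac-* x d y e = *≡* (cong (ℤ._* ℤ.+ suc (e + d * suc e)) (sym (ℤ.pos-* x y)))

frac-+ : ∀ x d y e → frac x d ℚᵘ.+ frac y e ≃ frac (x * suc e + y * suc d) (e + d * suc e)
frac-+ x d y e = *≡* (cong (ℤ._* ℤ.+ suc (e + d * suc e))
  (sym (trans (ℤ.pos-+ (x * suc e) (y * suc d)) (cong₂ ℤ._+_ (ℤ.pos-* x (suc e)) (ℤ.pos-* y (suc d))))))

toℚᵘ-/ : ∀ x d → toℚᵘ ((ℤ.+ x) ℚ./ suc d) ≃ frac x d
toℚᵘ-/ x d = ℚ.toℚᵘ-fromℚᵘ (frac x d)

toℚᵘ-expTerm : ∀ a n → toℚᵘ (expTerm a n) ≃ frac (a ^ n) (pred! n)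
toℚᵘ-expTerm a zero    = toℚᵘ-/ 1 0
toℚᵘ-expTerm a (suc n) = ℚᵘ.≃-trans (ℚ.toℚᵘ-homo-* (expTerm a n) ((ℤ.+ a) ℚ./ suc n))
  (ℚᵘ.≃-trans (ℚᵘ.*-cong (toℚᵘ-expTerm a n) (toℚᵘ-/ a n))
    (ℚᵘ.≃-trans (frac-* (a ^ n) (pred! n) a n) (frac-≃ (cong (_* suc (pred! (suc n))) (*-comm (a ^ n) a)))))

toℚᵘ-expPartial : ∀ a n → toℚᵘ (expPartial a n) ≃ frac (scaledExpSum a n) (pred! n)
toℚᵘ-expPartial a zero    = toℚᵘ-/ 0 0
toℚᵘ-expPartial a (suc n) = ℚᵘ.≃-trans (ℚ.toℚᵘ-homo-+ (expPartial a n) (expTerm a n))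
  (ℚᵘ.≃-trans (ℚᵘ.+-cong (toℚᵘ-expPartial a n) (toℚᵘ-expTerm a n))
    (ℚᵘ.≃-trans (frac-+ (scaledExpSum a n) (pred! n) (a ^ n) (pred! n))
      (frac-≃ (common-denominator (scaledExpSum a n) (a ^ n) (pred! n) n))))
  where
  common-denominator : ∀ P x f n → (P * suc f + x * suc f) * suc (n + f * suc n) ≡ (P + x) * suc n * suc (f + f * suc f)
  common-denominator = solve-∀

exp-≤ : ∀ a c → (a * 2 + 2) * 3 ^ a ≤ c → ExpLe a c
exp-≤ a c bound n = ℚ.toℚᵘ-cancel-≤
  (ℚᵘ.≤-respˡ-≃ (ℚᵘ.≃-sym (toℚᵘ-expPartial a n)) (ℚᵘ.≤-respʳ-≃ (ℚᵘ.≃-sym (toℚᵘ-/ c 0))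
    (frac-≤ (begin
      scaledExpSum a n * 1      ≡⟨ *-identityʳ _ ⟩
      scaledExpSum a n          ≤⟨ scaledExpSum-≤ a n ⟩
      (a * 2 + 2) * 3 ^ a * n ! ≤⟨ *-monoˡ-≤ (n !) bound ⟩
      c * n !                   ≡⟨ cong (c *_) (suc-pred! n) ⟨
      c * suc (pred! n)         ∎))))
  where open ≤-Reasoning

3^n-≥-quadratic : ∀ N → 3 ≤ N → N * N * 2 + 2 ≤ 3 ^ N
3^n-≥-quadratic N 3≤N = subst (λ M → M * M * 2 + 2 ≤ 3 ^ M) (m∸n+n≡m 3≤N) (shifted (N ∸ 3))
  where
  shifted : ∀ e → (e + 3) * (e + 3) * 2 + 2 ≤ 3 ^ (e + 3)
  shifted zero    = ≤ᵇ⇒≤ 20 27 _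
  shifted (suc e) = begin
    (suc e + 3) * (suc e + 3) * 2 + 2                             ≤⟨ m≤m+n _ (e * e * 4 + e * 20 + 26) ⟩
    (suc e + 3) * (suc e + 3) * 2 + 2 + (e * e * 4 + e * 20 + 26) ≡⟨ triple e ⟩
    ((e + 3) * (e + 3) * 2 + 2) * 3                               ≤⟨ *-monoˡ-≤ 3 (shifted e) ⟩
    3 ^ (e + 3) * 3                                               ≡⟨ *-comm (3 ^ (e + 3)) 3 ⟩
    3 * 3 ^ (e + 3)                                               ∎
    where
    open ≤-Reasoning
    triple : ∀ e → (suc e + 3) * (suc e + 3) * 2 + 2 + (e * e * 4 + e * 20 + 26) ≡ ((e + 3) * (e + 3) * 2 + 2) * 3
    triple = solve-∀

exp-≤-pow : ∀ a N ℓ d → a ≤ N * ℓ → ℓ ≤ N → 3 ≤ N → 3 ^ suc ℓ ≤ d → ExpLe a (d ^ N)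
exp-≤-pow a N ℓ d a≤Nℓ ℓ≤N 3≤N 3^[1+ℓ]≤d = exp-≤ a (d ^ N) (begin
  (a * 2 + 2) * 3 ^ a           ≤⟨ *-mono-≤ (+-monoˡ-≤ 2 (*-monoˡ-≤ 2 (≤-trans a≤Nℓ (*-monoʳ-≤ N ℓ≤N)))) (^-monoʳ-≤ 3 a≤Nℓ) ⟩
  (N * N * 2 + 2) * 3 ^ (N * ℓ) ≤⟨ *-monoˡ-≤ (3 ^ (N * ℓ)) (3^n-≥-quadratic N 3≤N) ⟩
  3 ^ N * 3 ^ (N * ℓ)           ≡⟨ ^-distribˡ-+-* 3 N (N * ℓ) ⟨
  3 ^ (N + N * ℓ)               ≡⟨ cong (3 ^_) (trans (sym (*-suc N ℓ)) (*-comm N (suc ℓ))) ⟩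
  3 ^ (suc ℓ * N)               ≡⟨ ^-*-assoc 3 (suc ℓ) N ⟨
  (3 ^ suc ℓ) ^ N               ≤⟨ ^-monoˡ-≤ N 3^[1+ℓ]≤d ⟩
  d ^ N                         ∎)
  where open ≤-Reasoning

m*n>0 : ∀ m n .{{_ : NonZero m}} .{{_ : NonZero n}} → 0 < m * n
m*n>0 m n = >-nonZero⁻¹ (m * n) {{m*n≢0 m n}}

^-cancelʳ-≤ : ∀ {x y} n → x ^ suc n ≤ y ^ suc n → x ≤ y
^-cancelʳ-≤ {x} {y} n xⁿ≤yⁿ with x ≤? y
... | yes x≤y = x≤y
... | no  x≰y = ⊥-elim (<⇒≱ (^-monoˡ-< (suc n) (≰⇒> x≰y)) xⁿ≤yⁿ)

∃-between : ∀ (g : ℕ → ℕ) → (∀ b → g b < g (suc b)) → ∀ X → g 0 ≤ X → ∃ λ b → g b ≤ X × X < g (suc b)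
∃-between g g-inc zero    g0≤X = 0 , g0≤X , ≤-<-trans z≤n (g-inc 0)
∃-between g g-inc (suc X) g0≤X with g 0 ≤? X
... | no  g0≰X = 0 , g0≤X , ≤-<-trans (≰⇒> g0≰X) (g-inc 0)
... | yes g0≤X' with ∃-between g g-inc X g0≤X'
...   | b , gb≤X , X<gb+1 with suc X <? g (suc b)
...     | yes X+1<gb+1 = b , m≤n⇒m≤1+n gb≤X , X+1<gb+1
...     | no  X+1≮gb+1 = suc b , ≮⇒≥ X+1≮gb+1 , ≤-<-trans X<gb+1 (g-inc (suc b))

n<3^n : ∀ n → n < 3 ^ n
n<3^n zero    = z<s
n<3^n (suc n) = ≤-trans (+-mono-≤ (m^n>0 3 n) (n<3^n n)) (+-monoʳ-≤ (3 ^ n) (m≤m+n (3 ^ n) (3 ^ n + 0)))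

-- (1 + 1/q)^q ≥ 49/20 by the second-order Bernoulli bound, and (49/20)^5 ≥ 81
[1+1/q]^5q-≥-81 : ∀ q → 10 ≤ q → 81 ÷ 1 ≤ (q + 1) ^ (q * 5) ÷ q ^ (q * 5)
[1+1/q]^5q-≥-81 q@(suc p) 10≤q =
  ÷-cong refl refl (^-*-assoc (q + 1) q 5) (^-*-assoc q q 5)
    (÷-trans (m^n>0 (2 * q * q) 5)
      (÷≤ (subst₂ _≤_ (*-comm ((2 * q * q) ^ 5) 81) (sym (*-identityʳ (L ^ 5))) (fifth-power (2 * q * q) L 49/20≤)))
      (÷-pow 5 second-order))
  where
  L = 2 * q * q + 2 * q * q + q * p
  second-order : L ÷ 2 * q * q ≤ (q + 1) ^ q ÷ q ^ q
  second-order = ÷≤ (≤-trans (≤-reflexive (*-comm L (q ^ q))) (bernoulli₂ q p))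
  49/20≤ : 2 * q * q * 49 ≤ L * 20
  49/20≤ = begin
    2 * q * q * 49                          ≡⟨ split p ⟩
    80 * q * q + (18 * q * p + q * (2 * 9)) ≤⟨ +-monoʳ-≤ (80 * q * q) (+-monoʳ-≤ (18 * q * p) (*-monoʳ-≤ q (*-monoʳ-≤ 2 (≤-pred 10≤q)))) ⟩
    80 * q * q + (18 * q * p + q * (2 * p)) ≡⟨ merge p ⟩
    L * 20                                  ∎
    where
    open ≤-Reasoning
    split : ∀ p → 2 * suc p * suc p * 49 ≡ 80 * suc p * suc p + (18 * suc p * p + suc p * (2 * 9))
    split = solve-∀
    merge : ∀ p → 80 * suc p * suc p + (18 * suc p * p + suc p * (2 * p)) ≡ (2 * suc p * suc p + 2 * suc p * suc p + suc p * p) * 20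
    merge = solve-∀
  fifth-power : ∀ y L → y * 49 ≤ L * 20 → y ^ 5 * 81 ≤ L ^ 5
  fifth-power y L y49≤L20 = *-cancelʳ-≤ _ _ 3200000 (begin
    y ^ 5 * 81 * 3200000 ≡⟨ *-assoc (y ^ 5) 81 3200000 ⟩
    y ^ 5 * 259200000    ≤⟨ *-monoʳ-≤ (y ^ 5) (≤ᵇ⇒≤ 259200000 282475249 _) ⟩
    y ^ 5 * 282475249    ≡⟨ ^-distribʳ-* y 49 5 ⟨
    (y * 49) ^ 5         ≤⟨ ^-monoˡ-≤ 5 y49≤L20 ⟩
    (L * 20) ^ 5         ≡⟨ ^-distribʳ-* L 20 5 ⟩
    L ^ 5 * 3200000      ∎)
    where open ≤-Reasoning

[1+1/ℓ]^10≤3 : ∀ ℓ → 15 ≤ ℓ → (ℓ + 1) ^ 10 ≤ ℓ ^ 10 * 3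
[1+1/ℓ]^10≤3 ℓ 15≤ℓ = *-cancelʳ-≤ _ _ ℓ {{>-nonZero (≤-trans z<s 15≤ℓ)}} (begin
  (ℓ + 1) ^ 10 * ℓ              ≤⟨ *-monoʳ-≤ ((ℓ + 1) ^ 10) ℓ≤3[ℓ-10] ⟩
  (ℓ + 1) ^ 10 * ((ℓ ∸ 10) * 3) ≡⟨ *-assoc ((ℓ + 1) ^ 10) (ℓ ∸ 10) 3 ⟨
  (ℓ + 1) ^ 10 * (ℓ ∸ 10) * 3   ≤⟨ *-monoˡ-≤ 3 (bernoulli-upper ℓ 10 (ℓ ∸ 10) (m+[n∸m]≡n 10≤ℓ)) ⟩
  ℓ ^ 10 * ℓ * 3                ≡⟨ swap (ℓ ^ 10) ℓ 3 ⟩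
  ℓ ^ 10 * 3 * ℓ                ∎)
  where
  open ≤-Reasoning
  10≤ℓ : 10 ≤ ℓ
  10≤ℓ = ≤-trans (≤ᵇ⇒≤ 10 15 _) 15≤ℓ
  swap : ∀ x y z → x * y * z ≡ x * z * y
  swap = solve-∀
  ℓ≤3[ℓ-10] : ℓ ≤ (ℓ ∸ 10) * 3
  ℓ≤3[ℓ-10] = +-cancelʳ-≤ 30 _ _ (begin
    ℓ + 30            ≤⟨ +-monoʳ-≤ ℓ (*-monoˡ-≤ 2 15≤ℓ) ⟩
    ℓ + ℓ * 2         ≡⟨ triple ℓ ⟩
    ℓ * 3             ≡⟨ cong (_* 3) (m∸n+n≡m 10≤ℓ) ⟨
    (ℓ ∸ 10 + 10) * 3 ≡⟨ *-distribʳ-+ 3 (ℓ ∸ 10) 10 ⟩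
    (ℓ ∸ 10) * 3 + 30 ∎)
    where
    triple : ∀ x → x + x * 2 ≡ x * 3
    triple = solve-∀

-- large enough that ℓ · logConstant · k ≤ d forces 1301 B ≤ A in TailEstimate
opaque
  logConstant : ℕ
  logConstant = 36 * 1301 * 1301

  logConstant≡ : logConstant ≡ 36 * 1301 * 1301
  logConstant≡ = refl

  [300·C]^10≤3^301 : (300 * logConstant) ^ 10 ≤ 3 ^ 301
  [300·C]^10≤3^301 = ≤ᵇ⇒≤ ((300 * logConstant) ^ 10) (3 ^ 301) _

[ℓ·C]^10≤3^[1+ℓ] : ∀ ℓ → 300 ≤ ℓ → (ℓ * logConstant) ^ 10 ≤ 3 ^ suc ℓ
[ℓ·C]^10≤3^[1+ℓ] ℓ 300≤ℓ =
  subst (λ i → (i * logConstant) ^ 10 ≤ 3 ^ suc i) (m∸n+n≡m 300≤ℓ)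
    (subst (λ i → ((ℓ ∸ 300 + 300) * logConstant) ^ 10 ≤ 3 ^ i) (+-suc (ℓ ∸ 300) 300) (from300 (ℓ ∸ 300)))
  where
  from300 : ∀ e → ((e + 300) * logConstant) ^ 10 ≤ 3 ^ (e + 301)
  from300 zero    = [300·C]^10≤3^301
  from300 (suc e) = begin
    ((suc e + 300) * logConstant) ^ 10    ≡⟨ ^-distribʳ-* (suc e + 300) logConstant 10 ⟩
    (suc e + 300) ^ 10 * logConstant ^ 10 ≡⟨ cong (λ i → i ^ 10 * logConstant ^ 10) (+-comm 1 (e + 300)) ⟩
    (e + 300 + 1) ^ 10 * logConstant ^ 10 ≤⟨ *-monoˡ-≤ (logConstant ^ 10) ([1+1/ℓ]^10≤3 (e + 300) (≤-trans (≤ᵇ⇒≤ 15 300 _) (m≤n+m 300 e))) ⟩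
    (e + 300) ^ 10 * 3 * logConstant ^ 10 ≡⟨ swap ((e + 300) ^ 10) 3 (logConstant ^ 10) ⟩
    (e + 300) ^ 10 * logConstant ^ 10 * 3 ≡⟨ cong (_* 3) (^-distribʳ-* (e + 300) logConstant 10) ⟨
    ((e + 300) * logConstant) ^ 10 * 3    ≤⟨ *-monoˡ-≤ 3 (from300 e) ⟩
    3 ^ (e + 301) * 3                     ≡⟨ *-comm (3 ^ (e + 301)) 3 ⟩
    3 ^ (suc e + 301)                     ∎
    where
    open ≤-Reasoning
    swap : ∀ x y z → x * y * z ≡ x * z * y
    swap = solve-∀

-- The exponent budget of the tail estimate: with q = ⌊A/B⌋, J ≈ A/(100(q+1)), j ≈ 3ℓ/4 and
-- 9ℓA < (B+1)², the exponents spent on the three error factors fit into B.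

J-bound : ∀ A B q J → A < suc q * B → suc q * 100 * J ≤ A + suc q * 100 → J * 52 * 100 ≤ B * 52 + 5148
J-bound A B q J A<[1+q]B [1+q]100J≤ = begin
  J * 52 * 100   ≡⟨ regroup J ⟩
  52 * (100 * J) ≤⟨ *-monoʳ-≤ 52 100J≤B+99 ⟩
  52 * (B + 99)  ≡⟨ expand B ⟩
  B * 52 + 5148  ∎
  where
  open ≤-Reasoning
  regroup : ∀ J → J * 52 * 100 ≡ 52 * (100 * J)
  regroup = solve-∀
  expand : ∀ B → 52 * (B + 99) ≡ B * 52 + 5148
  expand = solve-∀
  100J≤B+99 : 100 * J ≤ B + 99
  100J≤B+99 = ≤-pred (subst (100 * J <_) (+-suc B 99) (*-cancelˡ-< (suc q) (100 * J) (B + 100) (begin-strict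
    suc q * (100 * J)       ≡⟨ *-assoc (suc q) 100 J ⟨
    suc q * 100 * J         ≤⟨ [1+q]100J≤ ⟩
    A + suc q * 100         <⟨ +-monoˡ-< (suc q * 100) A<[1+q]B ⟩
    suc q * B + suc q * 100 ≡⟨ *-distribˡ-+ (suc q) B 100 ⟨
    suc q * (B + 100)       ∎)))

qℓ-bound : ∀ A B q ℓ → q * B ≤ A → ℓ * 9 * A < suc B * suc B → 300 ≤ ℓ → B * 1301 ≤ A → 1 ≤ B →
  q * ℓ * 750 + q * 3125 + 10496 ≤ B * 96
qℓ-bound A B q ℓ qB≤A 9ℓA<[B+1]² 300≤ℓ 1301B≤A B≥1 = *-cancelʳ-≤ _ _ B {{>-nonZero B≥1}} (+-cancelʳ-≤ (B * 192) _ _ (begin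
  (q * ℓ * 750 + q * 3125 + 10496) * B + B * 192 ≡⟨ regroup q B ℓ ⟩
  q * B * ℓ * 750 + q * B * 3125 + B * 10688     ≤⟨ +-monoˡ-≤ (B * 10688) (+-mono-≤ (*-monoˡ-≤ 750 (*-monoˡ-≤ ℓ qB≤A)) (*-monoˡ-≤ 3125 qB≤A)) ⟩
  A * ℓ * 750 + A * 3125 + B * 10688             ≤⟨ lower-order ⟩
  A * ℓ * 864                                    ≡⟨ regroup' A ℓ ⟩
  ℓ * 9 * A * 96                                 ≤⟨ *-monoˡ-≤ 96 (≤-pred (≤-trans 9ℓA<[B+1]² (≤-reflexive (square B)))) ⟩
  (B * B + B * 2) * 96                           ≡⟨ regroup'' B ⟩
  B * 96 * B + B * 192                           ∎))
  where
  open ≤-Reasoning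
  regroup : ∀ q B ℓ → (q * ℓ * 750 + q * 3125 + 10496) * B + B * 192 ≡ q * B * ℓ * 750 + q * B * 3125 + B * 10688
  regroup = solve-∀
  regroup' : ∀ A ℓ → A * ℓ * 864 ≡ ℓ * 9 * A * 96
  regroup' = solve-∀
  regroup'' : ∀ B → (B * B + B * 2) * 96 ≡ B * 96 * B + B * 192
  regroup'' = solve-∀
  square : ∀ B → suc B * suc B ≡ suc (B * B + B * 2)
  square = solve-∀
  lower-order : A * ℓ * 750 + A * 3125 + B * 10688 ≤ A * ℓ * 864
  lower-order = begin
    A * ℓ * 750 + A * 3125 + B * 10688   ≡⟨ +-assoc (A * ℓ * 750) _ _ ⟩
    A * ℓ * 750 + (A * 3125 + B * 10688) ≤⟨ +-monoʳ-≤ (A * ℓ * 750) (+-monoʳ-≤ (A * 3125) (*-monoˡ-≤ 10688 (≤-trans (m≤m*n B 1301) 1301B≤A))) ⟩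
    A * ℓ * 750 + (A * 3125 + A * 10688) ≡⟨ cong (A * ℓ * 750 +_) (*-distribˡ-+ A 3125 10688) ⟨
    A * ℓ * 750 + A * 13813              ≤⟨ +-monoʳ-≤ (A * ℓ * 750) (*-monoʳ-≤ A (≤-trans (≤ᵇ⇒≤ 13813 34200 _) (*-monoˡ-≤ 114 300≤ℓ))) ⟩
    A * ℓ * 750 + A * (ℓ * 114)          ≡⟨ cong (A * ℓ * 750 +_) (*-assoc A ℓ 114) ⟨
    A * ℓ * 750 + A * ℓ * 114            ≡⟨ *-distribˡ-+ (A * ℓ) 750 114 ⟨
    A * ℓ * 864                          ∎

exponent-budget : ∀ A B q J j ℓ →
  q * B ≤ A → A < suc q * B → suc q * 100 * J ≤ A + suc q * 100 → j * 40 ≤ ℓ * 30 + 125 →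
  ℓ * 9 * A < suc B * suc B → 300 ≤ ℓ → B * 1301 ≤ A → 1 ≤ B →
  1 + J * 52 + q * 5 * j ≤ B
exponent-budget A B q J j ℓ qB≤A A<[1+q]B [1+q]100J≤ 40j≤ 9ℓA<[B+1]² 300≤ℓ 1301B≤A B≥1 = *-cancelʳ-≤ _ _ 200 (begin
  (1 + J * 52 + q * 5 * j) * 200                          ≡⟨ regroup J q j ⟩
  200 + J * 52 * 100 * 2 + q * 5 * j * 8 * 25             ≤⟨ +-mono-≤ (+-monoʳ-≤ 200 (*-monoˡ-≤ 2 (J-bound A B q J A<[1+q]B [1+q]100J≤))) (*-monoˡ-≤ 25 j-bound) ⟩
  200 + (B * 52 + 5148) * 2 + (q * ℓ * 30 + q * 125) * 25 ≡⟨ regroup' B q ℓ ⟩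
  B * 104 + (q * ℓ * 750 + q * 3125 + 10496)              ≤⟨ +-monoʳ-≤ (B * 104) (qℓ-bound A B q ℓ qB≤A 9ℓA<[B+1]² 300≤ℓ 1301B≤A B≥1) ⟩
  B * 104 + B * 96                                        ≡⟨ *-distribˡ-+ B 104 96 ⟨
  B * 200                                                 ∎)
  where
  open ≤-Reasoning
  regroup : ∀ J q j → (1 + J * 52 + q * 5 * j) * 200 ≡ 200 + J * 52 * 100 * 2 + q * 5 * j * 8 * 25
  regroup = solve-∀
  regroup' : ∀ B q ℓ → 200 + (B * 52 + 5148) * 2 + (q * ℓ * 30 + q * 125) * 25 ≡ B * 104 + (q * ℓ * 750 + q * 3125 + 10496)
  regroup' = solve-∀
  j-bound : q * 5 * j * 8 ≤ q * ℓ * 30 + q * 125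
  j-bound = begin
    q * 5 * j * 8        ≡⟨ regroup'' q j ⟩
    q * (j * 40)         ≤⟨ *-monoʳ-≤ q 40j≤ ⟩
    q * (ℓ * 30 + 125)   ≡⟨ expand q ℓ ⟩
    q * ℓ * 30 + q * 125 ∎
    where
    regroup'' : ∀ q j → q * 5 * j * 8 ≡ q * (j * 40)
    regroup'' = solve-∀
    expand : ∀ q ℓ → q * (ℓ * 30 + 125) ≡ q * ℓ * 30 + q * 125
    expand = solve-∀

-- Excessive colour degrees are rare

<ᵇ≡true⇒< : ∀ {m n} → (m <ᵇ n) ≡ true → m < n
<ᵇ≡true⇒< {m} {n} eq = <ᵇ⇒< m n (subst T (sym eq) tt)

<ᵇ≡false⇒≥ : ∀ {m n} → (m <ᵇ n) ≡ false → n ≤ m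
<ᵇ≡false⇒≥ eq = ≮⇒≥ (λ m<n → subst T eq (<⇒<ᵇ m<n))

-- ℓ stands in for ln d: when 3^(ℓ+1) ≤ d, a colour degree that is not excessive satisfies Bound
excessive : (d k r ℓ p : ℕ) → Bool
excessive d k r ℓ p = (d * r <ᵇ k * p) ∧ (9 * d * k * r ^ 2 * ℓ <ᵇ (k * p ∸ d * r) ^ 2)

¬excessive⇒Bound : ∀ d k r ℓ p → 1 ≤ k → 1 ≤ r → 3 ^ suc ℓ ≤ d → excessive d k r ℓ p ≡ false → Bound d k p r
¬excessive⇒Bound d k r ℓ p k≥1 r≥1 3^[1+ℓ]≤d not-excessive with d * r <ᵇ k * p in above-mean
... | false = inj₁ (<ᵇ≡false⇒≥ above-mean)
... | true  = inj₂ (exp-≤-pow _ N ℓ d (<ᵇ≡false⇒≥ not-excessive) ℓ≤N 3≤N 3^[1+ℓ]≤d)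
  where
  N = 9 * d * k * r ^ 2
  d≤N : d ≤ N
  d≤N = ≤-trans (m≤n*m d 9) (≤-trans (m≤m*n (9 * d) k {{>-nonZero k≥1}}) (m≤m*n (9 * d * k) (r ^ 2) {{m^n≢0 r 2 {{>-nonZero r≥1}}}}))
  ℓ≤N : ℓ ≤ N
  ℓ≤N = ≤-trans (<⇒≤ (n<3^n ℓ)) (≤-trans (^-monoʳ-≤ 3 (n≤1+n ℓ)) (≤-trans 3^[1+ℓ]≤d d≤N))
  3≤N : 3 ≤ N
  3≤N = ≤-trans (m≤m*n 3 (3 ^ ℓ) {{m^n≢0 3 ℓ}}) (≤-trans 3^[1+ℓ]≤d d≤N)

excessive⇒≥ : ∀ d k r ℓ p A B → A * k ≤ d * r → k * (B * B) ≤ d * r * r * ℓ * 9 →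
  excessive d k r ℓ p ≡ true → A + B ≤ p
excessive⇒≥ d k r ℓ p A B Ak≤dr kB²≤ is-excessive with A + B ≤? p
... | yes A+B≤p = A+B≤p
... | no  A+B≰p = ⊥-elim (<⇒≱ (<ᵇ≡true⇒< (∧-conicalʳ _ _ is-excessive)) x²≤)
  where
  open ≤-Reasoning
  dr<kp : d * r < k * p
  dr<kp = <ᵇ≡true⇒< (∧-conicalˡ _ _ is-excessive)
  x = k * p ∸ d * r
  x≤kB : x ≤ k * B
  x≤kB = ≤-trans (m≤m+n x k) (+-cancelˡ-≤ (d * r) _ _ (begin
    d * r + (x + k) ≡⟨ +-assoc (d * r) x k ⟨
    d * r + x + k   ≡⟨ cong (_+ k) (m+[n∸m]≡n (<⇒≤ dr<kp)) ⟩
    k * p + k       ≡⟨ +-comm (k * p) k ⟩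
    k + k * p       ≡⟨ *-suc k p ⟨
    k * suc p       ≤⟨ *-monoʳ-≤ k (≰⇒> A+B≰p) ⟩
    k * (A + B)     ≡⟨ *-distribˡ-+ k A B ⟩
    k * A + k * B   ≤⟨ +-monoˡ-≤ (k * B) (≤-trans (≤-reflexive (*-comm k A)) Ak≤dr) ⟩
    d * r + k * B   ∎))
  x²≤ : (k * p ∸ d * r) ^ 2 ≤ 9 * d * k * r ^ 2 * ℓ
  x²≤ = begin
    x * (x * 1)                   ≡⟨ cong (x *_) (*-identityʳ x) ⟩
    x * x                         ≤⟨ *-mono-≤ x≤kB x≤kB ⟩
    k * B * (k * B)               ≡⟨ regroup k B ⟩
    k * (k * (B * B))             ≤⟨ *-monoʳ-≤ k kB²≤ ⟩
    k * (d * r * r * ℓ * 9)       ≡⟨ regroup' d k r ℓ ⟩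
    9 * d * k * (r * (r * 1)) * ℓ ∎
    where
    regroup : ∀ k B → k * B * (k * B) ≡ k * (k * (B * B))
    regroup = solve-∀
    regroup' : ∀ d k r ℓ → k * (d * r * r * ℓ * 9) ≡ 9 * d * k * (r * (r * 1)) * ℓ
    regroup' = solve-∀

record Regime (d k ℓ t : ℕ) : Set where
  field
    k≥1         : 1 ≤ k
    k¹⁰≤d⁹      : k ^ 10 ≤ d ^ 9
    3^[1+ℓ]≤d   : 3 ^ suc ℓ ≤ d
    d<3^[ℓ+2]   : d < 3 ^ (ℓ + 2)
    300≤ℓ       : 300 ≤ ℓ
    t²⁰≤d       : t ^ 20 ≤ d
    t≥1         : 1 ≤ t

module TailEstimate {d k ℓ t : ℕ} (regime : Regime d k ℓ t) (r m : ℕ) (r≥1 : 1 ≤ r) (m≤dr : m ≤ d * r) where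

  open Regime regime

  instance
    k≢0 : NonZero k
    k≢0 = >-nonZero k≥1

  Δ Z : ℕ
  Δ = d * t * (d * t)
  Z = 2 * k * (4 * suc Δ)

  -- A = ⌊d r / k⌋ is the mean colour-class size and B = ⌊√(9 d r² ℓ / k)⌋ the allowed excess
  opaque
    A-spec : ∃ λ A → A * k ≤ d * r × d * r < suc A * k
    A-spec = ∃-between (_* k) (λ a → m<n+m (a * k) k≥1) (d * r) z≤n

    B-spec : ∃ λ B → k * (B * B) ≤ d * r * r * ℓ * 9 × d * r * r * ℓ * 9 < k * (suc B * suc B)
    B-spec = ∃-between (λ b → k * (b * b)) (λ b → *-monoʳ-< k (*-mono-< (n<1+n b) (n<1+n b)))
                       (d * r * r * ℓ * 9) (≤-trans (≤-reflexive (*-zeroʳ k)) z≤n)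

  A B : ℕ
  A = proj₁ A-spec
  B = proj₁ B-spec

  Ak≤dr : A * k ≤ d * r
  Ak≤dr = proj₁ (proj₂ A-spec)

  dr<[1+A]k : d * r < suc A * k
  dr<[1+A]k = proj₂ (proj₂ A-spec)

  kB²≤ : k * (B * B) ≤ d * r * r * ℓ * 9
  kB²≤ = proj₁ (proj₂ B-spec)

  <k[1+B]² : d * r * r * ℓ * 9 < k * (suc B * suc B)
  <k[1+B]² = proj₂ (proj₂ B-spec)

  ℓCk≤d : ℓ * logConstant * k ≤ d
  ℓCk≤d = ^-cancelʳ-≤ 9 (begin
    (ℓ * logConstant * k) ^ 10      ≡⟨ ^-distribʳ-* (ℓ * logConstant) k 10 ⟩
    (ℓ * logConstant) ^ 10 * k ^ 10 ≤⟨ *-mono-≤ (≤-trans ([ℓ·C]^10≤3^[1+ℓ] ℓ 300≤ℓ) 3^[1+ℓ]≤d) k¹⁰≤d⁹ ⟩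
    d * d ^ 9                       ∎)
    where open ≤-Reasoning

  ℓ≢0 : NonZero ℓ
  ℓ≢0 = >-nonZero (≤-trans z<s 300≤ℓ)

  r≢0 : NonZero r
  r≢0 = >-nonZero r≥1

  k≤d : k ≤ d
  k≤d = ≤-trans (m≤n*m k (ℓ * logConstant) {{m*n≢0 ℓ logConstant {{ℓ≢0}} {{C≢0}}}}) ℓCk≤d
    where
    C≢0 : NonZero logConstant
    C≢0 = subst NonZero (sym logConstant≡) _

  A≥1 : 1 ≤ A
  A≥1 with A in A≡
  ... | suc _ = s≤s z≤n
  ... | zero  = ⊥-elim (<⇒≱ (subst (λ a → d * r < suc a * k) A≡ dr<[1+A]k)
                              (≤-trans (≤-reflexive (+-identityʳ k)) (≤-trans k≤d (m≤m*n d r {{r≢0}}))))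

  d≤dr²ℓ9 : d ≤ d * r * r * ℓ * 9
  d≤dr²ℓ9 = ≤-trans (m≤m*n d r {{r≢0}}) (≤-trans (m≤m*n (d * r) r {{r≢0}})
              (≤-trans (m≤m*n (d * r * r) ℓ {{ℓ≢0}}) (m≤m*n (d * r * r * ℓ) 9)))

  B≥1 : 1 ≤ B
  B≥1 with B in B≡
  ... | suc _ = s≤s z≤n
  ... | zero  = ⊥-elim (<⇒≱ (subst (λ b → d * r * r * ℓ * 9 < k * (suc b * suc b)) B≡ <k[1+B]²)
                              (≤-trans (≤-reflexive (*-identityʳ k)) (≤-trans k≤d d≤dr²ℓ9)))

  1301B≤A : B * 1301 ≤ A
  1301B≤A = ^-cancelʳ-≤ 1 (subst₂ _≤_ (cong ((B * 1301) *_) (sym (*-identityʳ _))) (cong (A *_) (sym (*-identityʳ A)))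
    (*-cancelˡ-≤ (k * k * 4) {{m*n≢0 (k * k) 4 {{m*n≢0 k k}}}} (begin
      k * k * 4 * (B * 1301 * (B * 1301))       ≡⟨ regroup k B ⟩
      k * (B * B) * (k * 4 * 1301 * 1301)       ≤⟨ *-monoˡ-≤ (k * 4 * 1301 * 1301) kB²≤ ⟩
      d * r * r * ℓ * 9 * (k * 4 * 1301 * 1301) ≡⟨ regroup' d r ℓ k ⟩
      d * r * r * (ℓ * (36 * 1301 * 1301) * k)  ≡⟨ cong (λ c → d * r * r * (ℓ * c * k)) logConstant≡ ⟨
      d * r * r * (ℓ * logConstant * k)         ≤⟨ *-monoʳ-≤ (d * r * r) ℓCk≤d ⟩
      d * r * r * d                             ≡⟨ regroup'' d r ⟩
      d * r * (d * r)                           ≤⟨ *-mono-≤ dr≤2Ak dr≤2Ak ⟩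
      A * k * 2 * (A * k * 2)                   ≡⟨ regroup''' A k ⟩
      k * k * 4 * (A * A)                       ∎)))
    where
    open ≤-Reasoning
    regroup : ∀ k B → k * k * 4 * (B * 1301 * (B * 1301)) ≡ k * (B * B) * (k * 4 * 1301 * 1301)
    regroup = solve-∀
    regroup' : ∀ d r ℓ k → d * r * r * ℓ * 9 * (k * 4 * 1301 * 1301) ≡ d * r * r * (ℓ * (36 * 1301 * 1301) * k)
    regroup' = solve-∀
    regroup'' : ∀ d r → d * r * r * d ≡ d * r * (d * r)
    regroup'' = solve-∀
    regroup''' : ∀ A k → A * k * 2 * (A * k * 2) ≡ k * k * 4 * (A * A)
    regroup''' = solve-∀
    dr≤2Ak : d * r ≤ A * k * 2
    dr≤2Ak = ≤-trans (<⇒≤ dr<[1+A]k) (≤-trans (+-monoˡ-≤ (A * k) (m≤n*m k A {{>-nonZero A≥1}})) (≤-reflexive (double (A * k))))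
      where
      double : ∀ x → x + x ≡ x * 2
      double = solve-∀

  -- the weight of a colour-class member is 1 + 1/q
  opaque
    q-spec : ∃ λ q → q * B ≤ A × A < suc q * B
    q-spec = ∃-between (_* B) (λ x → m<n+m (x * B) B≥1) A z≤n

  q : ℕ
  q = proj₁ q-spec

  qB≤A : q * B ≤ A
  qB≤A = proj₁ (proj₂ q-spec)

  A<[1+q]B : A < suc q * B
  A<[1+q]B = proj₂ (proj₂ q-spec)

  q≥1301 : 1301 ≤ q
  q≥1301 = ≤-pred (*-cancelʳ-< B 1301 (suc q) (≤-<-trans (≤-reflexive (*-comm 1301 B)) (≤-<-trans 1301B≤A A<[1+q]B)))

  instance
    q≢0 : NonZero q
    q≢0 = >-nonZero (≤-trans z<s q≥1301)

  K : ℕ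
  K = suc q * 100

  K>0 : 0 < K
  K>0 = z<s

  opaque
    J-spec : ∃ λ J → J * K ≤ A + K × A + K < suc J * K
    J-spec = ∃-between (_* K) (λ x → m<n+m (x * K) K>0) (A + K) z≤n

  J : ℕ
  J = proj₁ J-spec

  JK≤A+K : J * K ≤ A + K
  JK≤A+K = proj₁ (proj₂ J-spec)

  A+K<[1+J]K : A + K < suc J * K
  A+K<[1+J]K = proj₂ (proj₂ J-spec)

  1+A≤KJ : suc A ≤ K * J
  1+A≤KJ = subst (A <_) (*-comm J K) (+-cancelʳ-< K A (J * K) (subst (A + K <_) (+-comm K (J * K)) A+K<[1+J]K))

  -- 81^j bounds the local-lemma factor Z
  opaque
    j-spec : ∃ λ j → j * 40 ≤ ℓ * 30 + 125 × ℓ * 30 + 125 < suc j * 40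
    j-spec = ∃-between (_* 40) (λ x → m<n+m (x * 40) {40} z<s) (ℓ * 30 + 125) z≤n

  j : ℕ
  j = proj₁ j-spec

  40j≤ : j * 40 ≤ ℓ * 30 + 125
  40j≤ = proj₁ (proj₂ j-spec)

  <40[1+j] : ℓ * 30 + 125 < suc j * 40
  <40[1+j] = proj₂ (proj₂ j-spec)

  9ℓA<[1+B]² : ℓ * 9 * A < suc B * suc B
  9ℓA<[1+B]² = *-cancelˡ-< k (ℓ * 9 * A) (suc B * suc B) (≤-<-trans (begin
    k * (ℓ * 9 * A)     ≡⟨ regroup k ℓ A ⟩
    A * k * (ℓ * 9)     ≤⟨ *-monoˡ-≤ (ℓ * 9) Ak≤dr ⟩
    d * r * (ℓ * 9)     ≤⟨ *-monoˡ-≤ (ℓ * 9) (m≤m*n (d * r) r {{r≢0}}) ⟩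
    d * r * r * (ℓ * 9) ≡⟨ regroup' d r ℓ ⟩
    d * r * r * ℓ * 9   ∎) <k[1+B]²)
    where
    open ≤-Reasoning
    regroup : ∀ k ℓ A → k * (ℓ * 9 * A) ≡ A * k * (ℓ * 9)
    regroup = solve-∀
    regroup' : ∀ d r ℓ → d * r * r * (ℓ * 9) ≡ d * r * r * ℓ * 9
    regroup' = solve-∀

  budget : 1 + J * 52 + q * 5 * j ≤ B
  budget = exponent-budget A B q J j ℓ qB≤A A<[1+q]B (subst (_≤ A + K) (*-comm J K) JK≤A+K) 40j≤
             9ℓA<[1+B]² 300≤ℓ 1301B≤A B≥1

  V Rn Rq : ℕ
  V  = q * K
  Rn = V + 51
  Rq = q * q * 100 + q * 100 + 51

  instance
    V≢0 : NonZero V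
    V≢0 = m*n≢0 q K

    kq≢0 : NonZero (k * q)
    kq≢0 = m*n≢0 k q

  [1+1/kq]^m≤ : (k * q + 1) ^ m ÷ (k * q) ^ m ≤ (k * q + 1) ^ (k * suc A) ÷ (k * q) ^ (k * suc A)
  [1+1/kq]^m≤ = ÷-pow-mono m (k * suc A) (m≤m+n (k * q) 1) (≤-trans m≤dr (≤-trans (<⇒≤ dr<[1+A]k) (≤-reflexive (*-comm (suc A) k))))

  [1+1/kq]^k≤ : (k * q + 1) ^ k ÷ (k * q) ^ k ≤ Rq ÷ q * q * 100
  [1+1/kq]^k≤ = ÷-cancel (k * k) (m*n>0 k k) (÷≤ (begin
    (k * q + 1) ^ k * (k * k * (q * q * 100))
      ≡⟨ cong ((k * q + 1) ^ k *_) (regroup k q) ⟩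
    (k * q + 1) ^ k * (100 * (k * q) * (k * q))
      ≤⟨ pow-upper-quadratic (k * q) 1 k small ⟩
    (k * q) ^ k * (100 * (k * q) * (k * q) + 100 * k * 1 * (k * q) + 51 * k * k * 1 * 1)
      ≡⟨ cong ((k * q) ^ k *_) (regroup' k q) ⟩
    (k * q) ^ k * (k * k * Rq)
      ≡⟨ *-comm ((k * q) ^ k) _ ⟩
    k * k * Rq * (k * q) ^ k
      ∎))
    where
    open ≤-Reasoning
    regroup : ∀ k q → k * k * (q * q * 100) ≡ 100 * (k * q) * (k * q)
    regroup = solve-∀
    regroup' : ∀ k q → 100 * (k * q) * (k * q) + 100 * k * 1 * (k * q) + 51 * k * k * 1 * 1 ≡ k * k * (q * q * 100 + q * 100 + 51)
    regroup' = solve-∀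
    small : 51 * k * 1 ≤ 2 * (k * q)
    small = begin
      51 * k * 1  ≡⟨ regroup'' k ⟩
      k * 51      ≤⟨ *-monoʳ-≤ k (≤-trans (≤ᵇ⇒≤ 51 1301 _) (≤-trans q≥1301 (m≤m*n q 2))) ⟩
      k * (q * 2) ≡⟨ regroup''' k q ⟩
      2 * (k * q) ∎
      where
      regroup'' : ∀ k → 51 * k * 1 ≡ k * 51
      regroup'' = solve-∀
      regroup''' : ∀ k q → k * (q * 2) ≡ 2 * (k * q)
      regroup''' = solve-∀

  Rq-factor : Rq ÷ q * q * 100 ≤ suc q * Rn ÷ q * V
  Rq-factor = ÷-reflexive (identity q)
    where
    identity : ∀ q → (q * q * 100 + q * 100 + 51) * (q * (q * (suc q * 100))) ≡ suc q * (q * (suc q * 100) + 51) * (q * q * 100)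
    identity = solve-∀

  [1+1/q]^52-≥ : (q * q * 100 + q * 5100 + 132651) * q ^ 52 ≤ (q + 1) ^ 52 * (q * q * 100)
  [1+1/q]^52-≥ = begin
    (q * q * 100 + q * 5100 + 132651) * q ^ 52             ≤⟨ *-monoˡ-≤ (q ^ 52) (+-monoʳ-≤ (q * q * 100 + q * 5100) 51≤100q) ⟩
    (q * q * 100 + q * 5100 + (q * 100 + 132600)) * q ^ 52 ≡⟨ regroup q (q ^ 52) ⟩
    q ^ 52 * (2 * q * q + 2 * 52 * q + 52 * 51) * 50       ≤⟨ *-monoˡ-≤ 50 (bernoulli₂ q 51) ⟩
    (q + 1) ^ 52 * (2 * q * q) * 50                        ≡⟨ regroup' ((q + 1) ^ 52) q ⟩
    (q + 1) ^ 52 * (q * q * 100)                           ∎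
    where
    open ≤-Reasoning
    51≤100q : 132651 ≤ q * 100 + 132600
    51≤100q = +-monoˡ-≤ 132600 (≤-trans (≤ᵇ⇒≤ 51 1301 _) (≤-trans q≥1301 (m≤m*n q 100)))
    regroup : ∀ q x → (q * q * 100 + q * 5100 + (q * 100 + 132600)) * x ≡ x * (2 * q * q + 2 * 52 * q + 52 * 51) * 50
    regroup q x = scaled q x 102 2652 50
      where
      scaled : ∀ q x s t u → (q * q * (2 * u) + q * (s * u) + (q * (2 * u) + t * u)) * x ≡ x * (2 * q * q + (s + 2) * q + t) * u
      scaled = solve-∀
    regroup' : ∀ x q → x * (2 * q * q) * 50 ≡ x * (q * q * 100)
    regroup' = solve-∀

  [1+51/V]^K≤ : Rn ^ K ÷ V ^ K ≤ (q + 1) ^ 52 ÷ q ^ 52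
  [1+51/V]^K≤ = ÷-trans {c = 100 * V * V + 100 * K * 51 * V + 51 * K * K * 51 * 51} (m*n>0 (100 * V) V {{m*n≢0 100 V}})
    (÷≤ (≤-trans (pow-upper-quadratic V 51 K small) (≤-reflexive (*-comm (V ^ K) _))))
    (÷≤ (begin
      (100 * V * V + 100 * K * 51 * V + 51 * K * K * 51 * 51) * q ^ 52 ≡⟨ cong (_* q ^ 52) (regroup q K) ⟩
      K * K * (q * q * 100 + q * 5100 + 132651) * q ^ 52               ≡⟨ *-assoc (K * K) (q * q * 100 + q * 5100 + 132651) (q ^ 52) ⟩
      K * K * ((q * q * 100 + q * 5100 + 132651) * q ^ 52)             ≤⟨ *-monoʳ-≤ (K * K) [1+1/q]^52-≥ ⟩
      K * K * ((q + 1) ^ 52 * (q * q * 100))                           ≡⟨ regroup' ((q + 1) ^ 52) q K ⟩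
      (q + 1) ^ 52 * (100 * V * V)                                     ∎))
    where
    open ≤-Reasoning
    small : 51 * K * 51 ≤ 2 * V
    small = begin
      51 * K * 51 ≡⟨ regroup'' K ⟩
      K * 2601    ≤⟨ *-monoʳ-≤ K (≤-trans (≤ᵇ⇒≤ 2601 2602 _) (*-monoʳ-≤ 2 q≥1301)) ⟩
      K * (2 * q) ≡⟨ regroup''' K q ⟩
      2 * (q * K) ∎
      where
      regroup'' : ∀ K → 51 * K * 51 ≡ K * 2601
      regroup'' = solve-∀
      regroup''' : ∀ K q → K * (2 * q) ≡ 2 * (q * K)
      regroup''' = solve-∀
    regroup : ∀ q K → 100 * (q * K) * (q * K) + 100 * K * 51 * (q * K) + 51 * K * K * 51 * 51
                    ≡ K * K * (q * q * 100 + q * 5100 + 132651)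
    regroup = solve-∀
    regroup' : ∀ y q K → K * K * (y * (q * q * 100)) ≡ y * (100 * (q * K) * (q * K))
    regroup' = solve-∀

  Δ≥1 : 1 ≤ Δ
  Δ≥1 = *-mono-≤ dt≥1 dt≥1
    where
    dt≥1 : 1 ≤ d * t
    dt≥1 = *-mono-≤ (≤-trans k≥1 k≤d) t≥1

  Z≤16kΔ : Z ≤ k * Δ * 16
  Z≤16kΔ = begin
    2 * k * (4 * suc Δ)   ≡⟨ expand k Δ ⟩
    k * 8 + k * Δ * 8     ≤⟨ +-monoˡ-≤ (k * Δ * 8) (*-monoˡ-≤ 8 (m≤m*n k Δ {{>-nonZero Δ≥1}})) ⟩
    k * Δ * 8 + k * Δ * 8 ≡⟨ double (k * Δ) ⟩
    k * Δ * 16            ∎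
    where
    open ≤-Reasoning
    expand : ∀ k Δ → 2 * k * (4 * suc Δ) ≡ k * 8 + k * Δ * 8
    expand = solve-∀
    double : ∀ x → x * 8 + x * 8 ≡ x * 16
    double = solve-∀

  Δ^10 : Δ ^ 10 ≡ d ^ 20 * t ^ 20
  Δ^10 = begin
    (d * t * (d * t)) ^ 10      ≡⟨ ^-distribʳ-* (d * t) (d * t) 10 ⟩
    (d * t) ^ 10 * (d * t) ^ 10 ≡⟨ ^-distribˡ-+-* (d * t) 10 10 ⟨
    (d * t) ^ 20                ≡⟨ ^-distribʳ-* d t 20 ⟩
    d ^ 20 * t ^ 20             ∎
    where open ≡-Reasoning

  30[ℓ+2]+26≤40j : (ℓ + 2) * 30 + 26 ≤ j * 4 * 10
  30[ℓ+2]+26≤40j = begin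
    (ℓ + 2) * 30 + 26 ≡⟨ expand ℓ ⟩
    ℓ * 30 + 86       ≤⟨ +-cancelʳ-≤ 40 _ _ (≤-trans (≤-reflexive (shift ℓ)) (≤-trans <40[1+j] (≤-reflexive (+-comm 40 (j * 40))))) ⟩
    j * 40            ≡⟨ *-assoc j 4 10 ⟨
    j * 4 * 10        ∎
    where
    open ≤-Reasoning
    expand : ∀ ℓ → (ℓ + 2) * 30 + 26 ≡ ℓ * 30 + 86
    expand = solve-∀
    shift : ∀ ℓ → ℓ * 30 + 86 + 40 ≡ suc (ℓ * 30 + 125)
    shift = solve-∀

  Z≤3^4j : Z ≤ 3 ^ (j * 4)
  Z≤3^4j = ^-cancelʳ-≤ 9 (begin
    Z ^ 10                               ≤⟨ ^-monoˡ-≤ 10 Z≤16kΔ ⟩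
    (k * Δ * 16) ^ 10                    ≡⟨ ^-distribʳ-* (k * Δ) 16 10 ⟩
    (k * Δ) ^ 10 * 16 ^ 10               ≡⟨ cong (_* 16 ^ 10) (^-distribʳ-* k Δ 10) ⟩
    k ^ 10 * Δ ^ 10 * 16 ^ 10            ≡⟨ cong (λ x → k ^ 10 * x * 16 ^ 10) Δ^10 ⟩
    k ^ 10 * (d ^ 20 * t ^ 20) * 16 ^ 10 ≤⟨ *-mono-≤ (*-mono-≤ k¹⁰≤d⁹ (*-monoʳ-≤ (d ^ 20) t²⁰≤d)) (≤ᵇ⇒≤ (16 ^ 10) (3 ^ 26) _) ⟩
    d ^ 9 * (d ^ 20 * d) * 3 ^ 26        ≡⟨ cong (λ x → d ^ 9 * x * 3 ^ 26) (*-comm (d ^ 20) d) ⟩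
    d ^ 9 * d ^ 21 * 3 ^ 26              ≡⟨ cong (_* 3 ^ 26) (^-distribˡ-+-* d 9 21) ⟨
    d ^ 30 * 3 ^ 26                      ≤⟨ *-monoˡ-≤ (3 ^ 26) (^-monoˡ-≤ 30 (<⇒≤ d<3^[ℓ+2])) ⟩
    (3 ^ (ℓ + 2)) ^ 30 * 3 ^ 26          ≡⟨ cong (_* 3 ^ 26) (^-*-assoc 3 (ℓ + 2) 30) ⟩
    3 ^ ((ℓ + 2) * 30) * 3 ^ 26          ≡⟨ ^-distribˡ-+-* 3 ((ℓ + 2) * 30) 26 ⟨
    3 ^ ((ℓ + 2) * 30 + 26)              ≤⟨ ^-monoʳ-≤ 3 30[ℓ+2]+26≤40j ⟩
    3 ^ (j * 4 * 10)                     ≡⟨ ^-*-assoc 3 (j * 4) 10 ⟨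
    (3 ^ (j * 4)) ^ 10                   ∎)
    where open ≤-Reasoning

  Z≤[1+1/q]^5qj : Z ÷ 1 ≤ suc q ^ (q * 5 * j) ÷ q ^ (q * 5 * j)
  Z≤[1+1/q]^5qj = ÷-trans {d = 1} z<s
    (÷≤ (*-monoˡ-≤ 1 (≤-trans Z≤3^4j (≤-reflexive (trans (cong (3 ^_) (*-comm j 4)) (sym (^-*-assoc 3 4 j)))))))
    (÷-cong refl (^-zeroˡ j) (trans (^-*-assoc (q + 1) (q * 5) j) (cong (_^ (q * 5 * j)) (+-comm q 1))) (^-*-assoc q (q * 5) j)
      (÷-pow j ([1+1/q]^5q-≥-81 q (≤-trans (≤ᵇ⇒≤ 10 1301 _) q≥1301))))

  tail-ratio : (k * q + 1) ^ m * Z ÷ (k * q) ^ m * 1 ≤ suc q ^ (A + B) ÷ q ^ (A + B)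
  tail-ratio = ÷-trans (m^n>0 q E) (÷-cong refl refl (merge (suc q)) (merge q) (÷-mul step₄ Z≤[1+1/q]^5qj))
                 (÷-pow-mono E (A + B) (n≤1+n q) E≤A+B)
    where
    E = suc A + 52 * J + q * 5 * j
    E≤A+B : E ≤ A + B
    E≤A+B = ≤-trans (≤-reflexive (regroup A J (q * 5 * j))) (+-monoʳ-≤ A budget)
      where
      regroup : ∀ A J y → suc A + 52 * J + y ≡ A + (1 + J * 52 + y)
      regroup = solve-∀
    merge : ∀ x → x ^ suc A * x ^ (52 * J) * x ^ (q * 5 * j) ≡ x ^ E
    merge x = trans (cong (_* x ^ (q * 5 * j)) (sym (^-distribˡ-+-* x (suc A) (52 * J))))
                    (sym (^-distribˡ-+-* x (suc A + 52 * J) (q * 5 * j)))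
    step₁ : (k * q + 1) ^ m ÷ (k * q) ^ m ≤ Rq ^ suc A ÷ (q * q * 100) ^ suc A
    step₁ = ÷-trans (m^n>0 (k * q) (k * suc A)) [1+1/kq]^m≤
              (÷-cong (^-*-assoc (k * q + 1) k (suc A)) (^-*-assoc (k * q) k (suc A)) refl refl (÷-pow (suc A) [1+1/kq]^k≤))
    step₂ : (k * q + 1) ^ m ÷ (k * q) ^ m ≤ suc q ^ suc A * Rn ^ suc A ÷ q ^ suc A * V ^ suc A
    step₂ = ÷-trans (m^n>0 (q * q * 100) {{m*n≢0 (q * q) 100 {{m*n≢0 q q}}}} (suc A)) step₁
              (÷-cong refl refl (^-distribʳ-* (suc q) Rn (suc A)) (^-distribʳ-* q V (suc A)) (÷-pow (suc A) Rq-factor))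
    step₃ : (k * q + 1) ^ m ÷ (k * q) ^ m ≤ suc q ^ suc A * Rn ^ (K * J) ÷ q ^ suc A * V ^ (K * J)
    step₃ = ÷-trans (m*n>0 (q ^ suc A) (V ^ suc A) {{m^n≢0 q (suc A)}} {{m^n≢0 V (suc A)}}) step₂ (÷-mul (÷-refl {suc q ^ suc A} {q ^ suc A}) (÷-pow-mono (suc A) (K * J) (m≤m+n V 51) 1+A≤KJ))
    step₄ : (k * q + 1) ^ m ÷ (k * q) ^ m ≤ suc q ^ suc A * suc q ^ (52 * J) ÷ q ^ suc A * q ^ (52 * J)
    step₄ = ÷-trans (m*n>0 (q ^ suc A) (V ^ (K * J)) {{m^n≢0 q (suc A)}} {{m^n≢0 V (K * J)}}) step₃
              (÷-mul (÷-refl {suc q ^ suc A} {q ^ suc A}) (÷-cong (^-*-assoc Rn K J) (^-*-assoc V K J) q+1≡ (^-*-assoc q 52 J) (÷-pow J [1+51/V]^K≤)))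
      where
      q+1≡ : ((q + 1) ^ 52) ^ J ≡ suc q ^ (52 * J)
      q+1≡ = trans (^-*-assoc (q + 1) 52 J) (cong (_^ (52 * J)) (+-comm q 1))

excessive-rare : ∀ {d k ℓ t} → Regime d k ℓ t → ∀ r n (S : Fin n → Bool) (i : Fin k) →
  1 ≤ r → ∑[ u < n ] ⟦ S u ⟧ ≤ d * r →
  count n k (λ f → excessive d k r ℓ (∑[ u < n ] ⟦ S u ∧ does (f u Fin.≟ i) ⟧)) * (2 * k * (4 * suc (d * t * (d * t)))) ≤ k ^ n
excessive-rare {d} {k} {ℓ} regime r n S i r≥1 m≤dr =
  ≤-trans (*-monoˡ-≤ Z excessive⊆tail) (*-cancelʳ-≤ (c * Z) (k ^ n) W {{m*n≢0 (suc q ^ P) ((k * q) ^ m) {{m^n≢0 (suc q) P}} {{m^n≢0 (k * q) m}}}} (begin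
    c * Z * W                               ≡⟨ regroup c Z (suc q ^ P) ((k * q) ^ m) ⟩
    Z * (c * (suc q ^ P * (k * q) ^ m))     ≤⟨ *-monoʳ-≤ Z (tail-bound P) ⟩
    Z * (q ^ P * ((k * q + 1) ^ m * k ^ n)) ≡⟨ regroup' Z (q ^ P) ((k * q + 1) ^ m) (k ^ n) ⟩
    (k * q + 1) ^ m * Z * q ^ P * k ^ n     ≤⟨ *-monoˡ-≤ (k ^ n) (cross tail-ratio) ⟩
    suc q ^ P * ((k * q) ^ m * 1) * k ^ n   ≡⟨ regroup'' (suc q ^ P) ((k * q) ^ m) (k ^ n) ⟩
    k ^ n * W                               ∎))
  where
  open ≤-Reasoning
  m = ∑[ u < n ] ⟦ S u ⟧
  open TailEstimate regime r m r≥1 m≤dr using (A; B; Ak≤dr; kB²≤; q; q≢0; kq≢0; Z; tail-ratio)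
  open ColourClassTail S i q using (X; tail-bound)
  P = A + B
  c = count n k (λ f → P ≤ᵇ X f)
  W = suc q ^ P * (k * q) ^ m
  excessive⊆tail : count n k (λ f → excessive d k r ℓ (X f)) ≤ c
  excessive⊆tail = count-mono n _ _ (λ f is-excessive →
    Equivalence.to T-≡ (≤⇒≤ᵇ (excessive⇒≥ d k r ℓ (X f) A B Ak≤dr kB²≤ is-excessive)))
  regroup : ∀ c z a b → c * z * (a * b) ≡ z * (c * (a * b))
  regroup = solve-∀
  regroup' : ∀ z a b c → z * (a * (b * c)) ≡ b * z * a * c
  regroup' = solve-∀
  regroup'' : ∀ a b c → a * (b * 1) * c ≡ c * (a * b)
  regroup'' = solve-∀

maxFin-≥ : ∀ n (g : Fin n → ℕ) v → g v ≤ maxFin n g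
maxFin-≥ n g v = go n (λ u → u) v
  where
  go : ∀ m (h : Fin m → Fin n) u → g (h u) ≤ foldr _⊔_ 0 (map g (tabulate h))
  go (suc m) h zero    = m≤m⊔n _ _
  go (suc m) h (suc u) = ≤-trans (go m (h ∘ suc) u) (m≤n⊔m (g (h zero)) _)

ceilDiv-≤ : ∀ a r d → 1 ≤ r → ceilDiv a r ≤ d → a ≤ d * r
ceilDiv-≤ a (suc r) d _ ⌈a/r⌉≤d = +-cancelʳ-≤ r a (d * suc r) (≤-pred (begin-strict
  a + r                                     ≡⟨ m≡m%n+[m/n]*n (a + r) (suc r) ⟩
  (a + r) % suc r + (a + r) / suc r * suc r <⟨ +-mono-<-≤ (m%n<n (a + r) (suc r)) (*-monoˡ-≤ (suc r) ⌈a/r⌉≤d) ⟩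
  suc r + d * suc r                         ≡⟨ cong suc (+-comm r (d * suc r)) ⟩
  suc (d * suc r + r)                       ∎))
  where open ≤-Reasoning

countFin-cong : ∀ n {p q : Fin n → Bool} → (∀ u → p u ≡ q u) → countFin n p ≡ countFin n q
countFin-cong n p≡q = trans (countFin-∑ n _) (trans (sum-cong-≗ {n} (cong ⟦_⟧ ∘ p≡q)) (sym (countFin-∑ n _)))

overlaps-≤ : ∀ m n (S : Fin m → Fin n → Bool) R C →
  (∀ v → ∑[ u < n ] ⟦ S v u ⟧ ≤ R) → (∀ u → ∑[ w < m ] ⟦ S w u ⟧ ≤ C) →
  ∀ v → ∑[ w < m ] ⟦ anyᵇ n (λ u → S v u ∧ S w u) ⟧ ≤ R * C
overlaps-≤ m n S R C rows cols v = begin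
  ∑[ w < m ] ⟦ anyᵇ n (λ u → S v u ∧ S w u) ⟧ ≤⟨ ∑-mono-≤ m (λ w → ⟦anyᵇ⟧≤∑ n _) ⟩
  ∑[ w < m ] ∑[ u < n ] ⟦ S v u ∧ S w u ⟧     ≡⟨ ∑-comm {m} {n} (λ w u → ⟦ S v u ∧ S w u ⟧) ⟩
  ∑[ u < n ] ∑[ w < m ] ⟦ S v u ∧ S w u ⟧     ≡⟨ sum-cong-≗ {n} (λ u → trans (sum-cong-≗ {m} (λ w → ⟦∧⟧ (S v u) (S w u)))
                                                                                 (sym (*-distribˡ-sum {m} ⟦ S v u ⟧ _))) ⟩
  ∑[ u < n ] (⟦ S v u ⟧ * ∑[ w < m ] ⟦ S w u ⟧) ≤⟨ ∑-mono-≤ n (λ u → *-monoʳ-≤ ⟦ S v u ⟧ (cols u)) ⟩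
  ∑[ u < n ] (⟦ S v u ⟧ * C)                    ≡⟨ *-distribʳ-sum {n} C _ ⟨
  ∑[ u < n ] ⟦ S v u ⟧ * C                      ≤⟨ *-monoˡ-≤ C (rows v) ⟩
  R * C                                         ∎
  where open ≤-Reasoning

count-anyᵇ-≤ : ∀ n k m (P Q : Fin m → Colouring n k → Bool) →
  count n k (λ f → anyᵇ m (λ i → P i f ∨ Q i f)) ≤ ∑[ i < m ] (count n k (P i) + count n k (Q i))
count-anyᵇ-≤ n k m P Q = begin
  ∑ᶜ n k (λ f → ⟦ anyᵇ m (λ i → P i f ∨ Q i f) ⟧)   ≤⟨ ∑ᶜ-mono-≤ n (λ f → ≤-trans (⟦anyᵇ⟧≤∑ m _) (∑-mono-≤ m (λ i → ⟦∨⟧≤ (P i f) (Q i f)))) ⟩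
  ∑ᶜ n k (λ f → ∑[ i < m ] (⟦ P i f ⟧ + ⟦ Q i f ⟧)) ≡⟨ ∑ᶜ-∑ n m (λ i f → ⟦ P i f ⟧ + ⟦ Q i f ⟧) ⟩
  ∑[ i < m ] ∑ᶜ n k (λ f → ⟦ P i f ⟧ + ⟦ Q i f ⟧)   ≡⟨ sum-cong-≗ {m} (λ i → ∑ᶜ-distrib-+ n _ _) ⟩
  ∑[ i < m ] (count n k (P i) + count n k (Q i))    ∎
  where open ≤-Reasoning

d₀ : ℕ → ℕ
d₀ t = t ^ 20 + 3 ^ 302

module BalancedColouring (t : ℕ) (t≥2 : 2 ≤ t) (n : ℕ) (D : Digraph n) (f : Fin n → ℕ)
  (f≥2 : ∀ v → 2 ≤ f v) (f≤t : ∀ v → f v ≤ t)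
  (d₀≤d : d₀ t ≤ maxIndeg D ⊔ maxOutdegF D f) (k : ℕ) (k≥1 : 1 ≤ k)
  (k¹⁰≤d⁹ : k ^ 10 ≤ (maxIndeg D ⊔ maxOutdegF D f) ^ 9)
  where

  instance
    k≢0 : NonZero k
    k≢0 = >-nonZero k≥1

  d : ℕ
  d = maxIndeg D ⊔ maxOutdegF D f

  3^302≤d : 3 ^ 302 ≤ d
  3^302≤d = ≤-trans (m≤n+m (3 ^ 302) (t ^ 20)) d₀≤d

  -- ℓ = ⌊log₃ d⌋ - 1 plays the role of log d in the deviation bound
  opaque
    ℓ-spec : ∃ λ ℓ → 3 ^ suc ℓ ≤ d × d < 3 ^ suc (suc ℓ)
    ℓ-spec = ∃-between (λ e → 3 ^ suc e) (λ e → ^-monoʳ-< 3 (s≤s (s≤s z≤n)) (n<1+n (suc e))) d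
                       (≤-trans (^-monoʳ-≤ 3 {1} {302} (s≤s z≤n)) 3^302≤d)

  ℓ : ℕ
  ℓ = proj₁ ℓ-spec

  3^[1+ℓ]≤d : 3 ^ suc ℓ ≤ d
  3^[1+ℓ]≤d = proj₁ (proj₂ ℓ-spec)

  d<3^[ℓ+2] : d < 3 ^ (ℓ + 2)
  d<3^[ℓ+2] = subst (λ e → d < 3 ^ e) (+-comm 2 ℓ) (proj₂ (proj₂ ℓ-spec))

  300≤ℓ : 300 ≤ ℓ
  300≤ℓ with 300 ≤? ℓ
  ... | yes 300≤ℓ = 300≤ℓ
  ... | no  300≰ℓ = ⊥-elim (<⇒≱ (proj₂ (proj₂ ℓ-spec)) (≤-trans (^-monoʳ-≤ 3 (s≤s (s≤s (<⇒≤ (≰⇒> 300≰ℓ))))) 3^302≤d))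

  t≥1 : 1 ≤ t
  t≥1 = ≤-trans (s≤s z≤n) t≥2

  regime : Regime d k ℓ t
  regime = record
    { k≥1 = k≥1 ; k¹⁰≤d⁹ = k¹⁰≤d⁹ ; 3^[1+ℓ]≤d = 3^[1+ℓ]≤d ; d<3^[ℓ+2] = d<3^[ℓ+2] ; 300≤ℓ = 300≤ℓ
    ; t²⁰≤d = ≤-trans (m≤m+n (t ^ 20) (3 ^ 302)) d₀≤d ; t≥1 = t≥1 }

  r≥1 : ∀ v → 1 ≤ f v ∸ 1
  r≥1 v = ∸-monoˡ-≤ 1 (f≥2 v)

  indeg≤d : ∀ v → indeg D v ≤ d
  indeg≤d v = ≤-trans (maxFin-≥ n (indeg D) v) (m≤m⊔n _ _)

  outdeg≤d[f-1] : ∀ v → outdeg D v ≤ d * (f v ∸ 1)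
  outdeg≤d[f-1] v = ceilDiv-≤ (outdeg D v) (f v ∸ 1) d (r≥1 v)
    (≤-trans (maxFin-≥ n (λ v → ceilDiv (outdeg D v) (f v ∸ 1)) v) (m≤n⊔m (maxIndeg D) _))

  scope : Fin n → Fin n → Bool
  scope v u = arc D u v ∨ arc D v u

  scope-size : ∀ v → ∑[ u < n ] ⟦ scope v u ⟧ ≤ d * t
  scope-size v = begin
    ∑[ u < n ] ⟦ arc D u v ∨ arc D v u ⟧                ≤⟨ ∑-mono-≤ n (λ u → ⟦∨⟧≤ (arc D u v) (arc D v u)) ⟩
    ∑[ u < n ] (⟦ arc D u v ⟧ + ⟦ arc D v u ⟧)          ≡⟨ ∑-distrib-+ {n} _ _ ⟩
    ∑[ u < n ] ⟦ arc D u v ⟧ + ∑[ u < n ] ⟦ arc D v u ⟧ ≡⟨ cong₂ _+_ (countFin-∑ n _) (countFin-∑ n _) ⟨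
    indeg D v + outdeg D v                              ≤⟨ +-mono-≤ (indeg≤d v) (≤-trans (outdeg≤d[f-1] v) (*-monoʳ-≤ d (∸-monoˡ-≤ 1 (f≤t v)))) ⟩
    d + d * (t ∸ 1)                                     ≡⟨ *-suc d (t ∸ 1) ⟨
    d * suc (t ∸ 1)                                     ≡⟨ cong (d *_) (trans (+-comm 1 (t ∸ 1)) (m∸n+n≡m t≥1)) ⟩
    d * t                                               ∎
    where open ≤-Reasoning

  in-excessive out-excessive : Fin n → Fin k → Colouring n k → Bool
  in-excessive  v i c = excessive d k 1 ℓ (indegCol D c v i)
  out-excessive v i c = excessive d k (f v ∸ 1) ℓ (outdegCol D c v i)

  bad : Fin n → Colouring n k → Bool
  bad v c = anyᵇ k (λ i → in-excessive v i c ∨ out-excessive v i c)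

  bad-local : ∀ v → DependsOnlyOn (scope v) (bad v)
  bad-local v c c' agree = anyᵇ-cong k (λ i → cong₂ _∨_
      (cong (excessive d k 1 ℓ) (countFin-cong n (λ u → on-arc (arc D u v) (λ uv → agree u (cong (_∨ arc D v u) uv)))))
      (cong (excessive d k (f v ∸ 1) ℓ) (countFin-cong n (λ u → on-arc (arc D v u) (λ vu → agree u (trans (cong (arc D u v ∨_) vu) (∨-comm _ true)))))))
    where
    on-arc : ∀ {u i} a → (a ≡ true → c u ≡ c' u) → a ∧ does (c u Fin.≟ i) ≡ a ∧ does (c' u Fin.≟ i)
    on-arc true  same = cong (λ x → does (x Fin.≟ _)) (same refl)
    on-arc false _    = refl

  Δ : ℕ
  Δ = d * t * (d * t)

  rare : ∀ v → count n k (bad v) * (4 * suc Δ) ≤ k ^ n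
  rare v = *-cancelʳ-≤ _ _ (2 * k) {{m*n≢0 2 k}} (begin
    count n k (bad v) * (4 * suc Δ) * (2 * k) ≡⟨ regroup (count n k (bad v)) (4 * suc Δ) (2 * k) ⟩
    count n k (bad v) * Z                     ≤⟨ *-monoˡ-≤ Z (count-anyᵇ-≤ n k k (in-excessive v) (out-excessive v)) ⟩
    ∑[ i < k ] (count n k (in-excessive v i) + count n k (out-excessive v i)) * Z
                                                           ≡⟨ *-distribʳ-sum {k} Z _ ⟩
    ∑[ i < k ] ((count n k (in-excessive v i) + count n k (out-excessive v i)) * Z)
                                                           ≤⟨ ∑-mono-≤ k (λ i → ≤-trans (≤-reflexive (*-distribʳ-+ Z (count n k (in-excessive v i)) (count n k (out-excessive v i)))) (+-mono-≤ (in-rare i) (out-rare i))) ⟩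
    ∑[ i < k ] (k ^ n + k ^ n) ≡⟨ ∑-const k _ ⟩
    k * (k ^ n + k ^ n)        ≡⟨ regroup' k (k ^ n) ⟩
    k ^ n * (2 * k)            ∎)
    where
    open ≤-Reasoning
    Z = 2 * k * (4 * suc Δ)
    regroup : ∀ x y z → x * y * z ≡ x * (z * y)
    regroup = solve-∀
    regroup' : ∀ k y → k * (y + y) ≡ y * (2 * k)
    regroup' = solve-∀
    in-rare : ∀ i → count n k (in-excessive v i) * Z ≤ k ^ n
    in-rare i = subst (λ x → x * Z ≤ k ^ n)
      (count-cong n _ _ (λ c → cong (excessive d k 1 ℓ) (sym (countFin-∑ n _))))
      (excessive-rare regime 1 n (λ u → arc D u v) i ≤-refl (subst (_≤ d * 1) (countFin-∑ n _) (≤-trans (indeg≤d v) (≤-reflexive (sym (*-identityʳ d))))))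
    out-rare : ∀ i → count n k (out-excessive v i) * Z ≤ k ^ n
    out-rare i = subst (λ x → x * Z ≤ k ^ n)
      (count-cong n _ _ (λ c → cong (excessive d k (f v ∸ 1) ℓ) (sym (countFin-∑ n _))))
      (excessive-rare regime (f v ∸ 1) n (λ u → arc D v u) i (r≥1 v) (subst (_≤ d * (f v ∸ 1)) (countFin-∑ n _) (outdeg≤d[f-1] v)))

  scope-size′ : ∀ u → ∑[ w < n ] ⟦ scope w u ⟧ ≤ d * t
  scope-size′ u = subst (_≤ d * t) (sum-cong-≗ {n} (λ w → cong ⟦_⟧ (∨-comm (arc D w u) (arc D u w)))) (scope-size u)

  open LocalLemma bad scope bad-local Δ (overlaps-≤ n n scope (d * t) (d * t) scope-size scope-size′) rare
    using (lovász-local-lemma)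

  balanced : Σ (Fin n → Fin k) λ c → (v : Fin n) (i : Fin k) →
    Bound d k (indegCol D c v i) 1 × Bound d k (outdegCol D c v i) (f v ∸ 1)
  balanced =
    let c , good = lovász-local-lemma in
    c , λ v i → let balanced-i = anyᵇ-elim k (good v) i in
      ¬excessive⇒Bound d k 1 ℓ _ k≥1 ≤-refl 3^[1+ℓ]≤d (∨-conicalˡ _ _ balanced-i) ,
      ¬excessive⇒Bound d k (f v ∸ 1) ℓ _ k≥1 (r≥1 v) 3^[1+ℓ]≤d (∨-conicalʳ _ _ balanced-i)

lemma18 : (t : ℕ) → 2 ≤ t →
    Σ ℕ λ d₀ →
      (n : ℕ) (D : Digraph n) (f : Fin n → ℕ) →
      (∀ v → 2 ≤ f v) → (∀ v → f v ≤ t) →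
      d₀ ≤ maxIndeg D ⊔ maxOutdegF D f →
      (k : ℕ) → 1 ≤ k → k ^ 10 ≤ (maxIndeg D ⊔ maxOutdegF D f) ^ 9 →
      Σ (Fin n → Fin k) λ c →
        (v : Fin n) (i : Fin k) →
          Bound (maxIndeg D ⊔ maxOutdegF D f) k (indegCol D c v i) 1
          × Bound (maxIndeg D ⊔ maxOutdegF D f) k (outdegCol D c v i) (f v ∸ 1)
lemma18 t t≥2 = d₀ t , λ n D f f≥2 f≤t d₀≤d k k≥1 k¹⁰≤d⁹ →
  BalancedColouring.balanced t t≥2 n D f f≥2 f≤t d₀≤d k k≥1 k¹⁰≤d⁹
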